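{- Let $S = \{(a_1,b_1),\dots,(a_r,b_r)\} \subset \mathbb{A}^2(\mathbb{Q})$ be an acceptable set with $|S| = r$. Put $d = 18r+3$ and $m = \prod_{1 \le j < k \le r} (a_j - a_k)$. Let $n \ge r$ be an integer. Then there exists an irreducible polynomial $h(X) = \sum_{i=0}^{n} \alpha_i X^i \in \mathbb{Q}[X]$ such that: (i) $h(a_i) = b_i^{d}$ for all $1 \le i \le r$; (ii) $h$ has degree $n$; (iii) $m \cdot h(X) \in \mathbb{Z}[X]$.
   Context: A finite set $S = \{(a_1,b_1),\dots,(a_r,b_r)\} \subset \mathbb{A}^2(\mathbb{Q})$ of distinct rational points is called acceptable if (i) $a_i = a_j$ implies $b_i = b_j$ (so the $a_i$ are pairwise distinct), (ii) $a_i \neq 0$ and $b_j \neq 0$ for all $i,j$, and (iii) $a_i, b_j \in \mathbb{Z}$ for all $i,j$. -}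

module Defs where

open import Data.Nat as ℕ using (ℕ; zero; suc)
open import Data.Integer as ℤ using (ℤ; +_)
open import Data.Rational as ℚ using (ℚ; 0ℚ; 1ℚ)
open import Data.List using (List; []; _∷_; map; foldr)
open import Data.Fin using (Fin)
open import Data.Product using (_×_; ∃)
open import Data.Sum using (_⊎_)
open import Relation.Binary.PropositionalEquality using (_≡_)
open import Relation.Nullary using (¬_)

toℚ : ℤ → ℚ
toℚ z = z ℚ./ 1

-- Polynomials in ℚ[X], represented by coefficient lists
-- (constant coefficient first); trailing zeros allowed.

Poly : Set
Poly = List ℚ

coeff : Poly → ℕ → ℚ
coeff []       _       = 0ℚ
coeff (a ∷ p)  zero    = a
coeff (a ∷ p)  (suc i) = coeff p i

_≈ₚ_ : Poly → Poly → Set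
p ≈ₚ q = ∀ i → coeff p i ≡ coeff q i

0ₚ : Poly
0ₚ = []

1ₚ : Poly
1ₚ = 1ℚ ∷ []

_+ₚ_ : Poly → Poly → Poly
[]      +ₚ q       = q
(a ∷ p) +ₚ []      = a ∷ p
(a ∷ p) +ₚ (b ∷ q) = (a ℚ.+ b) ∷ (p +ₚ q)

_*ₚ_ : Poly → Poly → Poly
[]      *ₚ q = []
(a ∷ p) *ₚ q = map (a ℚ.*_) q +ₚ (0ℚ ∷ (p *ₚ q))

eval : Poly → ℚ → ℚ
eval []      x = 0ℚ
eval (a ∷ p) x = a ℚ.+ x ℚ.* eval p x

IsUnit : Poly → Set
IsUnit p = ∃ λ q → (p *ₚ q) ≈ₚ 1ₚ

Irreducible : Poly → Set
Irreducible p =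
  ¬ (p ≈ₚ 0ₚ) × ¬ IsUnit p ×
  (∀ f g → p ≈ₚ (f *ₚ g) → IsUnit f ⊎ IsUnit g)

-- Acceptable sets, given as the lists of coordinates a, b : Fin r → ℤ
-- (integrality (iii) is built in by taking ℤ-valued coordinates).

Acceptable : (r : ℕ) → (Fin r → ℤ) → (Fin r → ℤ) → Set
Acceptable r a b =
  (∀ i j → a i ≡ a j → i ≡ j) ×
  (∀ i → ¬ (a i ≡ + 0)) ×
  (∀ j → ¬ (b j ≡ + 0))

prodDiffs : List ℤ → ℤ
prodDiffs []       = + 1
prodDiffs (x ∷ xs) = foldr ℤ._*_ (+ 1) (map (λ y → x ℤ.- y) xs) ℤ.* prodDiffs xs

-- Interpolate the values m·bᵢᵈ at the nodes aᵢ by an integer polynomial P of degree < r (Newton's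
-- scheme; the factor m = ∏ⱼ<ₖ (aⱼ − aₖ) keeps it integral) and add fresh integer nodes, changing P
-- by multiples of ∏ (X − z) over the current nodes, until there are n nodes, at none of which P
-- vanishes.  With Π = ∏ (X − z) over these nodes and V = Σ |P(z)|, the polynomial H = P + L·Π has
-- degree n, leading coefficient L and values 0 < |H(z)| ≤ V at the n nodes.  If H = F·G over ℤ
-- with both factors of positive degree, then F and G are bounded by V at more nodes than their
-- degrees, so repeated division by X − z bounds their leading coefficients by 2ⁿV; this is
-- impossible once L > (2ⁿV)².  By Gauss's lemma H has no proper factorisation over ℚ either, and
-- α = H/m is the required polynomial.

module Submission where

open import Algebra.Bundles using (CommutativeRing)
open import Algebra.Core using (Op₁; Op₂)
open import Algebra.Structures using (IsCommutativeRing)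
open import Data.Fin using (Fin; zero; suc; toℕ)
open import Data.Integer as ℤ using (ℤ)
open import Data.Integer.Divisibility.Signed using (divides; _∣?_; ∣m+n∣m⇒∣n; ∣m⇒∣m*n; ∣⇒∣ᵤ; ∣ᵤ⇒∣)
  renaming (_∣_ to _∣ℤ_)
import Data.Integer.Properties as ℤ
open import Data.Integer.Tactic.RingSolver using (solve-∀)
open import Data.List using (List; []; _∷_; map; length; foldr; tabulate)
open import Data.List.Membership.Propositional using (_∈_)
open import Data.List.Membership.Propositional.Properties using (∈-map⁺; ∈-tabulate⁺)
import Data.List.Properties as List
open import Data.List.Relation.Unary.All as All using (All; []; _∷_)
import Data.List.Relation.Unary.All.Properties as All
open import Data.List.Relation.Unary.AllPairs using ([]; _∷_)
open import Data.List.Relation.Unary.Any using (here; there)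
open import Data.List.Relation.Unary.Unique.Propositional using (Unique)
import Data.List.Relation.Unary.Unique.Propositional.Properties as Unique
open import Data.Nat as ℕ using (ℕ; zero; suc)
import Data.Nat.Divisibility as ℕ
open import Data.Nat.Induction using (<-wellFounded)
open import Data.Nat.ListAction using (sum; product)
open import Data.Nat.Primality using (Prime; euclidsLemma; prime⇒nonZero; prime⇒nonTrivial)
open import Data.Nat.Primality.Factorisation using (factorise)
import Data.Nat.Properties as ℕ
import Data.Nat.Tactic.RingSolver as ℕ-Solver
open import Data.Product using (_×_; _,_; ∃; proj₁; proj₂)
open import Data.Rational as ℚ using (ℚ; 0ℚ; 1ℚ; mkℚ; ↥_; ↧_; ↧ₙ_)
import Data.Rational.Properties as ℚ
open import Data.Rational.Unnormalised as ℚᵘ using (mkℚᵘ; *≡*)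
import Data.Rational.Unnormalised.Properties as ℚᵘ
open import Data.Sum as Sum using (_⊎_; inj₁; inj₂; [_,_]′)
open import Data.Vec using (Vec; []; _∷_; toList; lookup; last)
open import Function using (_∘_; id; flip)
open import Induction.WellFounded using (Acc; acc)
open import Relation.Binary.Definitions using (DecidableEquality; tri<; tri≈; tri>)
open import Relation.Binary.PropositionalEquality
open import Relation.Nullary using (¬_; Dec; yes; no; contradiction)

open import Defs using (toℚ; prodDiffs)

module Polynomial {A : Set} {add mul : Op₂ A} {neg : Op₁ A} {0# 1# : A}
                  (isCommutativeRing : IsCommutativeRing _≡_ add mul neg 0# 1#) where

  infixl 6 _+_
  infixl 7 _*_

  _+_ _*_ : Op₂ A
  _+_ = add
  _*_ = mul

  commutativeRing : CommutativeRing _ _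
  commutativeRing = record { isCommutativeRing = isCommutativeRing }

  open CommutativeRing commutativeRing
    using ( +-assoc; +-comm; +-identityˡ; +-identityʳ; *-assoc; *-comm
          ; distribˡ; distribʳ; zeroˡ; zeroʳ; +-commutativeSemigroup; *-commutativeSemigroup )
  open import Algebra.Properties.CommutativeSemigroup +-commutativeSemigroup
    using () renaming (interchange to +-interchange; x∙yz≈y∙xz to +-left-comm)
  open import Algebra.Properties.CommutativeSemigroup *-commutativeSemigroup
    using () renaming (x∙yz≈y∙xz to *-left-comm)
  open ≡-Reasoning

  infix  4 _≈ₚ_
  infixl 6 _+ₚ_
  infixr 8 _·ₚ_
  infixl 7 _*ₚ_

  -- These repeat the definitions in Defs clause by clause, so that at ℚ the two agree
  -- (coeff-Defs, *ₚ-Defs and eval-Defs below).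

  coeff : List A → ℕ → A
  coeff []      _       = 0#
  coeff (a ∷ p) zero    = a
  coeff (a ∷ p) (suc i) = coeff p i

  _≈ₚ_ : List A → List A → Set
  p ≈ₚ q = ∀ i → coeff p i ≡ coeff q i

  _+ₚ_ : List A → List A → List A
  []      +ₚ q       = q
  (a ∷ p) +ₚ []      = a ∷ p
  (a ∷ p) +ₚ (b ∷ q) = (a + b) ∷ (p +ₚ q)

  _·ₚ_ : A → List A → List A
  c ·ₚ p = map (c *_) p

  _*ₚ_ : List A → List A → List A
  []      *ₚ q = []
  (a ∷ p) *ₚ q = a ·ₚ q +ₚ (0# ∷ p *ₚ q)

  eval : List A → A → A
  eval []      x = 0#
  eval (a ∷ p) x = a + x * eval p x

  DegreeBelow : List A → ℕ → Set
  DegreeBelow p k = ∀ j → coeff p (k ℕ.+ j) ≡ 0#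

  Constant : List A → Set
  Constant p = DegreeBelow p 1

  HasDegree : List A → ℕ → Set
  HasDegree p s = DegreeBelow p (suc s) × coeff p s ≢ 0#

  coeff-+ₚ : ∀ p q i → coeff (p +ₚ q) i ≡ coeff p i + coeff q i
  coeff-+ₚ []      q       i       = sym (+-identityˡ _)
  coeff-+ₚ (a ∷ p) []      i       = sym (+-identityʳ _)
  coeff-+ₚ (a ∷ p) (b ∷ q) zero    = refl
  coeff-+ₚ (a ∷ p) (b ∷ q) (suc i) = coeff-+ₚ p q i

  coeff-·ₚ : ∀ c p i → coeff (c ·ₚ p) i ≡ c * coeff p i
  coeff-·ₚ c []      i       = sym (zeroʳ c)
  coeff-·ₚ c (a ∷ p) zero    = refl
  coeff-·ₚ c (a ∷ p) (suc i) = coeff-·ₚ c p i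

  coeff-*ₚ-zero : ∀ p q → coeff (p *ₚ q) 0 ≡ coeff p 0 * coeff q 0
  coeff-*ₚ-zero []      q = sym (zeroˡ _)
  coeff-*ₚ-zero (a ∷ p) q = begin
    coeff (a ·ₚ q +ₚ (0# ∷ p *ₚ q)) 0 ≡⟨ coeff-+ₚ (a ·ₚ q) _ 0 ⟩
    coeff (a ·ₚ q) 0 + 0#             ≡⟨ +-identityʳ _ ⟩
    coeff (a ·ₚ q) 0                  ≡⟨ coeff-·ₚ a q 0 ⟩
    a * coeff q 0                     ∎

  coeff-∷*ₚ-suc : ∀ a p q i → coeff ((a ∷ p) *ₚ q) (suc i) ≡ a * coeff q (suc i) + coeff (p *ₚ q) i
  coeff-∷*ₚ-suc a p q i = trans (coeff-+ₚ (a ·ₚ q) _ (suc i)) (cong (_+ _) (coeff-·ₚ a q (suc i)))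

  coeff-*ₚ-[] : ∀ p i → coeff (p *ₚ []) i ≡ 0#
  coeff-*ₚ-[] []      i       = refl
  coeff-*ₚ-[] (a ∷ p) zero    = refl
  coeff-*ₚ-[] (a ∷ p) (suc i) = coeff-*ₚ-[] p i

  coeff-*ₚ-∷ : ∀ p b q i → coeff (p *ₚ (b ∷ q)) (suc i) ≡ b * coeff p (suc i) + coeff (p *ₚ q) i
  coeff-*ₚ-∷ []      b q i = sym (trans (cong (_+ 0#) (zeroʳ b)) (+-identityˡ 0#))
  coeff-*ₚ-∷ (a ∷ p) b q zero = begin
    coeff ((a ∷ p) *ₚ (b ∷ q)) 1             ≡⟨ coeff-∷*ₚ-suc a p (b ∷ q) 0 ⟩
    a * coeff q 0 + coeff (p *ₚ (b ∷ q)) 0   ≡⟨ cong (a * coeff q 0 +_) (coeff-*ₚ-zero p (b ∷ q)) ⟩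
    a * coeff q 0 + coeff p 0 * b            ≡⟨ +-comm _ _ ⟩
    coeff p 0 * b + a * coeff q 0            ≡⟨ cong₂ _+_ (*-comm _ b) (sym (coeff-*ₚ-zero (a ∷ p) q)) ⟩
    b * coeff p 0 + coeff ((a ∷ p) *ₚ q) 0   ∎
  coeff-*ₚ-∷ (a ∷ p) b q (suc i) = begin
    coeff ((a ∷ p) *ₚ (b ∷ q)) (suc (suc i))
      ≡⟨ coeff-∷*ₚ-suc a p (b ∷ q) (suc i) ⟩
    a * coeff q (suc i) + coeff (p *ₚ (b ∷ q)) (suc i)
      ≡⟨ cong (a * coeff q (suc i) +_) (coeff-*ₚ-∷ p b q i) ⟩
    a * coeff q (suc i) + (b * coeff p (suc i) + coeff (p *ₚ q) i)
      ≡⟨ +-left-comm _ _ _ ⟩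
    b * coeff p (suc i) + (a * coeff q (suc i) + coeff (p *ₚ q) i)
      ≡⟨ cong (b * coeff p (suc i) +_) (sym (coeff-∷*ₚ-suc a p q i)) ⟩
    b * coeff p (suc i) + coeff ((a ∷ p) *ₚ q) (suc i) ∎

  *ₚ-comm : ∀ p q → p *ₚ q ≈ₚ q *ₚ p
  *ₚ-comm []      q i       = sym (coeff-*ₚ-[] q i)
  *ₚ-comm (a ∷ p) q zero    =
    trans (coeff-*ₚ-zero (a ∷ p) q) (trans (*-comm a _) (sym (coeff-*ₚ-zero q (a ∷ p))))
  *ₚ-comm (a ∷ p) q (suc i) = begin
    coeff ((a ∷ p) *ₚ q) (suc i)             ≡⟨ coeff-∷*ₚ-suc a p q i ⟩
    a * coeff q (suc i) + coeff (p *ₚ q) i   ≡⟨ cong (a * coeff q (suc i) +_) (*ₚ-comm p q i) ⟩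
    a * coeff q (suc i) + coeff (q *ₚ p) i   ≡⟨ coeff-*ₚ-∷ q a p i ⟨
    coeff (q *ₚ (a ∷ p)) (suc i)             ∎

  coeff-·ₚ-*ₚ : ∀ c p q i → coeff (c ·ₚ p *ₚ q) i ≡ c * coeff (p *ₚ q) i
  coeff-·ₚ-*ₚ c []      q i       = sym (zeroʳ c)
  coeff-·ₚ-*ₚ c (a ∷ p) q zero    = begin
    coeff (c ·ₚ (a ∷ p) *ₚ q) 0  ≡⟨ coeff-*ₚ-zero (c ·ₚ (a ∷ p)) q ⟩
    c * a * coeff q 0            ≡⟨ *-assoc c a _ ⟩
    c * (a * coeff q 0)          ≡⟨ cong (c *_) (coeff-*ₚ-zero (a ∷ p) q) ⟨
    c * coeff ((a ∷ p) *ₚ q) 0   ∎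
  coeff-·ₚ-*ₚ c (a ∷ p) q (suc i) = begin
    coeff (c ·ₚ (a ∷ p) *ₚ q) (suc i)                   ≡⟨ coeff-∷*ₚ-suc (c * a) (c ·ₚ p) q i ⟩
    c * a * coeff q (suc i) + coeff (c ·ₚ p *ₚ q) i     ≡⟨ cong₂ _+_ (*-assoc c a _) (coeff-·ₚ-*ₚ c p q i) ⟩
    c * (a * coeff q (suc i)) + c * coeff (p *ₚ q) i    ≡⟨ distribˡ c _ _ ⟨
    c * (a * coeff q (suc i) + coeff (p *ₚ q) i)        ≡⟨ cong (c *_) (coeff-∷*ₚ-suc a p q i) ⟨
    c * coeff ((a ∷ p) *ₚ q) (suc i)                    ∎

  coeff-*ₚ-·ₚ : ∀ c p q i → coeff (p *ₚ c ·ₚ q) i ≡ c * coeff (p *ₚ q) i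
  coeff-*ₚ-·ₚ c p q i = begin
    coeff (p *ₚ c ·ₚ q) i   ≡⟨ *ₚ-comm p (c ·ₚ q) i ⟩
    coeff (c ·ₚ q *ₚ p) i   ≡⟨ coeff-·ₚ-*ₚ c q p i ⟩
    c * coeff (q *ₚ p) i    ≡⟨ cong (c *_) (*ₚ-comm q p i) ⟩
    c * coeff (p *ₚ q) i    ∎

  ·ₚ-·ₚ : ∀ c d p → c ·ₚ (d ·ₚ p) ≡ (c * d) ·ₚ p
  ·ₚ-·ₚ c d p = trans (sym (List.map-∘ p)) (List.map-cong (λ x → sym (*-assoc c d x)) p)

  ≈[]-*ₚ : ∀ p q → p ≈ₚ [] → p *ₚ q ≈ₚ []
  ≈[]-*ₚ []      q p≈0 i       = refl
  ≈[]-*ₚ (a ∷ p) q p≈0 zero    = trans (coeff-*ₚ-zero (a ∷ p) q) (trans (cong (_* _) (p≈0 0)) (zeroˡ _))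
  ≈[]-*ₚ (a ∷ p) q p≈0 (suc i) = begin
    coeff ((a ∷ p) *ₚ q) (suc i)             ≡⟨ coeff-∷*ₚ-suc a p q i ⟩
    a * coeff q (suc i) + coeff (p *ₚ q) i   ≡⟨ cong₂ _+_ (cong (_* _) (p≈0 0)) (≈[]-*ₚ p q (p≈0 ∘ suc) i) ⟩
    0# * coeff q (suc i) + 0#                ≡⟨ trans (+-identityʳ _) (zeroˡ _) ⟩
    0#                                       ∎

  *ₚ-≈[] : ∀ p q → q ≈ₚ [] → p *ₚ q ≈ₚ []
  *ₚ-≈[] p q q≈0 i = trans (*ₚ-comm p q i) (≈[]-*ₚ q p q≈0 i)

  eval-+ₚ : ∀ p q x → eval (p +ₚ q) x ≡ eval p x + eval q x
  eval-+ₚ []      q       x = sym (+-identityˡ _)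
  eval-+ₚ (a ∷ p) []      x = sym (+-identityʳ _)
  eval-+ₚ (a ∷ p) (b ∷ q) x = begin
    a + b + x * eval (p +ₚ q) x                 ≡⟨ cong (λ e → a + b + x * e) (eval-+ₚ p q x) ⟩
    a + b + x * (eval p x + eval q x)           ≡⟨ cong (a + b +_) (distribˡ x _ _) ⟩
    a + b + (x * eval p x + x * eval q x)       ≡⟨ +-interchange a b _ _ ⟩
    a + x * eval p x + (b + x * eval q x)       ∎

  eval-·ₚ : ∀ c p x → eval (c ·ₚ p) x ≡ c * eval p x
  eval-·ₚ c []      x = sym (zeroʳ c)
  eval-·ₚ c (a ∷ p) x = begin
    c * a + x * eval (c ·ₚ p) x    ≡⟨ cong (λ e → c * a + x * e) (eval-·ₚ c p x) ⟩
    c * a + x * (c * eval p x)     ≡⟨ cong (c * a +_) (*-left-comm x c _) ⟩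
    c * a + c * (x * eval p x)     ≡⟨ distribˡ c _ _ ⟨
    c * (a + x * eval p x)         ∎

  eval-*ₚ : ∀ p q x → eval (p *ₚ q) x ≡ eval p x * eval q x
  eval-*ₚ []      q x = sym (zeroˡ _)
  eval-*ₚ (a ∷ p) q x = begin
    eval (a ·ₚ q +ₚ (0# ∷ p *ₚ q)) x
      ≡⟨ eval-+ₚ (a ·ₚ q) _ x ⟩
    eval (a ·ₚ q) x + (0# + x * eval (p *ₚ q) x)
      ≡⟨ cong₂ _+_ (eval-·ₚ a q x) (trans (+-identityˡ _) (cong (x *_) (eval-*ₚ p q x))) ⟩
    a * eval q x + x * (eval p x * eval q x)
      ≡⟨ cong (a * eval q x +_) (*-assoc x _ _) ⟨
    a * eval q x + x * eval p x * eval q x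
      ≡⟨ distribʳ _ a _ ⟨
    (a + x * eval p x) * eval q x ∎

  eval-≈[] : ∀ p x → p ≈ₚ [] → eval p x ≡ 0#
  eval-≈[] []      x p≈0 = refl
  eval-≈[] (a ∷ p) x p≈0 = begin
    a + x * eval p x   ≡⟨ cong₂ (λ u v → u + x * v) (p≈0 0) (eval-≈[] p x (p≈0 ∘ suc)) ⟩
    0# + x * 0#        ≡⟨ trans (+-identityˡ _) (zeroʳ x) ⟩
    0#                 ∎

  eval-cong : ∀ p q x → p ≈ₚ q → eval p x ≡ eval q x
  eval-cong []      q       x p≈q = sym (eval-≈[] q x (sym ∘ p≈q))
  eval-cong (a ∷ p) []      x p≈q = eval-≈[] (a ∷ p) x p≈q
  eval-cong (a ∷ p) (b ∷ q) x p≈q = cong₂ (λ u v → u + x * v) (p≈q 0) (eval-cong p q x (p≈q ∘ suc))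

  eval-constant : ∀ p x → Constant p → eval p x ≡ coeff p 0
  eval-constant []      x _ = refl
  eval-constant (a ∷ p) x c =
    trans (cong (λ e → a + x * e) (eval-≈[] p x c)) (trans (cong (a +_) (zeroʳ x)) (+-identityʳ a))

  coeff-beyond : ∀ p {k i} → DegreeBelow p k → k ℕ.≤ i → coeff p i ≡ 0#
  coeff-beyond p {k} {i} dp k≤i = subst (λ j → coeff p j ≡ 0#) (ℕ.m+[n∸m]≡n k≤i) (dp (i ℕ.∸ k))

  DegreeBelow-mono : ∀ p {k l} → k ℕ.≤ l → DegreeBelow p k → DegreeBelow p l
  DegreeBelow-mono p {l = l} k≤l dp j = coeff-beyond p dp (ℕ.≤-trans k≤l (ℕ.m≤m+n l j))

  DegreeBelow-+ₚ : ∀ p q {k} → DegreeBelow p k → DegreeBelow q k → DegreeBelow (p +ₚ q) k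
  DegreeBelow-+ₚ p q {k} dp dq j =
    trans (coeff-+ₚ p q (k ℕ.+ j)) (trans (cong₂ _+_ (dp j) (dq j)) (+-identityˡ 0#))

  DegreeBelow-·ₚ : ∀ c p {k} → DegreeBelow p k → DegreeBelow (c ·ₚ p) k
  DegreeBelow-·ₚ c p {k} dp j = trans (coeff-·ₚ c p (k ℕ.+ j)) (trans (cong (c *_) (dp j)) (zeroʳ c))

  DegreeBelow-*ₚ : ∀ p q s t → DegreeBelow p (suc s) → DegreeBelow q (suc t) →
                   DegreeBelow (p *ₚ q) (suc (s ℕ.+ t))
  DegreeBelow-*ₚ []      q s       t dp dq j = refl
  DegreeBelow-*ₚ (a ∷ p) q zero    t dp dq j = begin
    coeff ((a ∷ p) *ₚ q) (suc (t ℕ.+ j))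
      ≡⟨ coeff-∷*ₚ-suc a p q (t ℕ.+ j) ⟩
    a * coeff q (suc (t ℕ.+ j)) + coeff (p *ₚ q) (t ℕ.+ j)
      ≡⟨ cong₂ _+_ (cong (a *_) (dq j)) (≈[]-*ₚ p q dp _) ⟩
    a * 0# + 0#
      ≡⟨ trans (+-identityʳ _) (zeroʳ a) ⟩
    0# ∎
  DegreeBelow-*ₚ (a ∷ p) q (suc s) t dp dq j = begin
    coeff ((a ∷ p) *ₚ q) (suc (suc (s ℕ.+ t ℕ.+ j)))                    ≡⟨ coeff-∷*ₚ-suc a p q _ ⟩
    a * coeff q (suc (suc (s ℕ.+ t ℕ.+ j))) + coeff (p *ₚ q) (suc (s ℕ.+ t ℕ.+ j))
      ≡⟨ cong₂ _+_ (cong (a *_) (coeff-beyond q dq t<)) (DegreeBelow-*ₚ p q s t dp dq j) ⟩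
    a * 0# + 0#                                                         ≡⟨ trans (+-identityʳ _) (zeroʳ a) ⟩
    0#                                                                  ∎
    where
    t< : suc t ℕ.≤ suc (suc (s ℕ.+ t ℕ.+ j))
    t< = ℕ.s≤s (ℕ.m≤n⇒m≤1+n (ℕ.≤-trans (ℕ.m≤n+m t s) (ℕ.m≤m+n _ j)))

  coeff-*ₚ-leading : ∀ p q s t → DegreeBelow p (suc s) → DegreeBelow q (suc t) →
                     coeff (p *ₚ q) (s ℕ.+ t) ≡ coeff p s * coeff q t
  coeff-*ₚ-leading []      q s       t       dp dq = sym (zeroˡ _)
  coeff-*ₚ-leading (a ∷ p) q zero    zero    dp dq = coeff-*ₚ-zero (a ∷ p) q
  coeff-*ₚ-leading (a ∷ p) q zero    (suc t) dp dq =
    trans (coeff-∷*ₚ-suc a p q t) (trans (cong (_ +_) (≈[]-*ₚ p q dp t)) (+-identityʳ _))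
  coeff-*ₚ-leading (a ∷ p) q (suc s) t       dp dq = begin
    coeff ((a ∷ p) *ₚ q) (suc (s ℕ.+ t))
      ≡⟨ coeff-∷*ₚ-suc a p q _ ⟩
    a * coeff q (suc (s ℕ.+ t)) + coeff (p *ₚ q) (s ℕ.+ t)
      ≡⟨ cong₂ _+_ (cong (a *_) (coeff-beyond q dq (ℕ.s≤s (ℕ.m≤n+m t s)))) (coeff-*ₚ-leading p q s t dp dq) ⟩
    a * 0# + coeff p s * coeff q t
      ≡⟨ trans (cong (_+ coeff p s * coeff q t) (zeroʳ a)) (+-identityˡ _) ⟩
    coeff p s * coeff q t ∎

  HasDegree-cong : ∀ p q {s} → p ≈ₚ q → HasDegree p s → HasDegree q s
  HasDegree-cong p q {s} p≈q (dp , p≢0) =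
    (λ j → trans (sym (p≈q (suc s ℕ.+ j))) (dp j)) , λ q≡0 → p≢0 (trans (p≈q s) q≡0)

  HasDegree-unique : ∀ p q {s t} → p ≈ₚ q → HasDegree p s → HasDegree q t → s ≡ t
  HasDegree-unique p q {s} {t} p≈q (dp , p≢0) (dq , q≢0) with ℕ.<-cmp s t
  ... | tri< s<t _ _ = contradiction (trans (sym (p≈q t)) (coeff-beyond p dp s<t)) q≢0
  ... | tri≈ _ s≡t _ = s≡t
  ... | tri> _ _ t<s = contradiction (trans (p≈q s) (coeff-beyond q dq t<s)) p≢0

  ≈[]⊎HasDegree : DecidableEquality A → ∀ p → p ≈ₚ [] ⊎ ∃ (HasDegree p)
  ≈[]⊎HasDegree _≟_ []      = inj₁ (λ _ → refl)
  ≈[]⊎HasDegree _≟_ (a ∷ p) with ≈[]⊎HasDegree _≟_ p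
  ... | inj₂ (s , dp , lp) = inj₂ (suc s , dp , lp)
  ... | inj₁ p≈0 with a ≟ 0#
  ...   | yes a≡0 = inj₁ λ { zero → a≡0 ; (suc i) → p≈0 i }
  ...   | no  a≢0 = inj₂ (0 , p≈0 , a≢0)

  module IntegralDomain (noZeroDivisors : ∀ {x y} → x * y ≡ 0# → x ≡ 0# ⊎ y ≡ 0#) where

    DegreeBelow-·ₚ⁻¹ : ∀ {c} p {k} → c ≢ 0# → DegreeBelow (c ·ₚ p) k → DegreeBelow p k
    DegreeBelow-·ₚ⁻¹ {c} p {k} c≢0 dcp j =
      [ flip contradiction c≢0 , id ]′ (noZeroDivisors (trans (sym (coeff-·ₚ c p (k ℕ.+ j))) (dcp j)))

    HasDegree-·ₚ⁻¹ : ∀ {c} p {s} → c ≢ 0# → HasDegree (c ·ₚ p) s → HasDegree p s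
    HasDegree-·ₚ⁻¹ {c} p {s} c≢0 (dcp , cp≢0) =
      DegreeBelow-·ₚ⁻¹ p c≢0 dcp , λ p≡0 → cp≢0 (trans (coeff-·ₚ c p s) (trans (cong (c *_) p≡0) (zeroʳ c)))

    HasDegree-*ₚ : ∀ {p q s t} → HasDegree p s → HasDegree q t → HasDegree (p *ₚ q) (s ℕ.+ t)
    HasDegree-*ₚ {p} {q} {s} {t} (dp , p≢0) (dq , q≢0) =
      DegreeBelow-*ₚ p q s t dp dq ,
      λ eq → [ p≢0 , q≢0 ]′ (noZeroDivisors (trans (sym (coeff-*ₚ-leading p q s t dp dq)) eq))

    positiveDegree⇒¬*ₚ≈1 : DecidableEquality A → 1# ≢ 0# →
                            ∀ {p s} q → HasDegree p (suc s) → ¬ (p *ₚ q ≈ₚ 1# ∷ [])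
    positiveDegree⇒¬*ₚ≈1 _≟_ 1≢0 {p} q hp pq≈1 with ≈[]⊎HasDegree _≟_ q
    ... | inj₁ q≈0       = 1≢0 (trans (sym (pq≈1 0)) (*ₚ-≈[] p q q≈0 0))
    ... | inj₂ (t , hq)  = proj₂ (HasDegree-*ₚ {p} {q} hp hq) (pq≈1 _)

-- Gauss's lemma

module ℤ[X] = Polynomial ℤ.+-*-isCommutativeRing

primeFactor : ∀ n → 2 ℕ.≤ n → ∃ λ p → Prime p × p ℕ.∣ n
primeFactor n@(suc _) 2≤n with factorise n
... | record { factors = [] ; isFactorisation = n≡1 } = contradiction (sym n≡1) (ℕ.<⇒≢ 2≤n)
... | record { factors = p ∷ ps ; isFactorisation = eq ; factorsPrime = prime-p ∷ _ } =
  p , prime-p , ℕ.divides (product ps) (trans eq (ℕ.*-comm p (product ps)))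

ℤ-noZeroDivisors : ∀ {x y} → x ℤ.* y ≡ ℤ.0ℤ → x ≡ ℤ.0ℤ ⊎ y ≡ ℤ.0ℤ
ℤ-noZeroDivisors {x} = ℤ.i*j≡0⇒i≡0∨j≡0 x

module _ where
  open ℤ[X] hiding (_+_; _*_)
  open ℤ[X].IntegralDomain ℤ-noZeroDivisors
  open import Data.Integer using (+_; ∣_∣; 0ℤ; 1ℤ; _+_; _*_; _-_; -_)
  open import Algebra.Properties.CommutativeSemigroup ℤ.*-commutativeSemigroup using (x∙yz≈y∙xz; xy∙z≈xz∙y)

  _∣ₚ_ : ℕ → List ℤ → Set
  q ∣ₚ F = ∀ i → + q ∣ℤ coeff F i

  euclidsLemmaℤ : ∀ {p} → Prime p → ∀ x y → + p ∣ℤ x * y → + p ∣ℤ x ⊎ + p ∣ℤ y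
  euclidsLemmaℤ {p} p-prime x y p∣xy
    with euclidsLemma ∣ x ∣ ∣ y ∣ p-prime (subst (p ℕ.∣_) (ℤ.abs-* x y) (∣⇒∣ᵤ p∣xy))
  ... | inj₁ p∣x = inj₁ (∣ᵤ⇒∣ p∣x)
  ... | inj₂ p∣y = inj₂ (∣ᵤ⇒∣ p∣y)

  ∣ₚ-*ₚ-∷ : ∀ {p} → Prime p → ∀ a F G → ¬ + p ∣ℤ a → p ∣ₚ ((a ∷ F) *ₚ G) → p ∣ₚ G
  ∣ₚ-*ₚ-∷ {p} p-prime a F []      p∤a p∣aFG i = divides 0ℤ refl
  ∣ₚ-*ₚ-∷ {p} p-prime a F (b ∷ G) p∤a p∣aFbG = p∣bG
    where
    p∣b : + p ∣ℤ b
    p∣b with euclidsLemmaℤ p-prime a b (subst (+ p ∣ℤ_) (coeff-*ₚ-zero (a ∷ F) (b ∷ G)) (p∣aFbG 0))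
    ... | inj₁ p∣a = contradiction p∣a p∤a
    ... | inj₂ p∣b = p∣b
    p∣bG : p ∣ₚ (b ∷ G)
    p∣bG zero    = p∣b
    p∣bG (suc i) = ∣ₚ-*ₚ-∷ p-prime a F G p∤a
      (λ j → ∣m+n∣m⇒∣n (subst (+ p ∣ℤ_) (coeff-*ₚ-∷ (a ∷ F) b G j) (p∣aFbG (suc j))) (∣m⇒∣m*n _ p∣b)) i

  ∣ₚ-*ₚ : ∀ {p} → Prime p → ∀ F G → p ∣ₚ (F *ₚ G) → p ∣ₚ F ⊎ p ∣ₚ G
  ∣ₚ-*ₚ p-prime []      G p∣FG = inj₁ (λ _ → divides 0ℤ refl)
  ∣ₚ-*ₚ {p} p-prime (a ∷ F) G p∣aFG with + p ∣? a
  ... | no  p∤a = inj₂ (∣ₚ-*ₚ-∷ p-prime a F G p∤a p∣aFG)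
  ... | yes p∣a with ∣ₚ-*ₚ p-prime F G p∣FG
    where
    p∣FG : p ∣ₚ (F *ₚ G)
    p∣FG i = ∣m+n∣m⇒∣n (subst (+ p ∣ℤ_) (coeff-∷*ₚ-suc a F G i) (p∣aFG (suc i))) (∣m⇒∣m*n _ p∣a)
  ...   | inj₂ p∣G = inj₂ p∣G
  ...   | inj₁ p∣F = inj₁ λ { zero → p∣a ; (suc i) → p∣F i }

  NoProperFactorisation : List ℤ → Set
  NoProperFactorisation H = ∀ F G → F *ₚ G ≈ₚ H → Constant F ⊎ Constant G

  ∣ₚ⇒·ₚ : ∀ {p} F → p ∣ₚ F → ∃ λ F₁ → F ≡ (+ p) ·ₚ F₁
  ∣ₚ⇒·ₚ []      p∣F = [] , refl
  ∣ₚ⇒·ₚ {p} (a ∷ F) p∣aF with p∣aF 0 | ∣ₚ⇒·ₚ F (p∣aF ∘ suc)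
  ... | divides k a≡kp | F₁ , F≡pF₁ = k ∷ F₁ , cong₂ _∷_ (trans a≡kp (ℤ.*-comm k (+ p))) F≡pF₁

  cancelPrime : ∀ {p} → Prime p → ∀ m x K′ h → m * (+ p * x) ≡ + (K′ ℕ.* p) * h → m * x ≡ + K′ * h
  cancelPrime {p} p-prime m x K′ h eq =
    ℤ.*-cancelˡ-≡ (+ p) (m * x) (+ K′ * h) {{prime⇒nonZero p-prime}} (begin
    + p * (m * x)      ≡⟨ x∙yz≈y∙xz (+ p) m x ⟩
    m * (+ p * x)      ≡⟨ eq ⟩
    + (K′ ℕ.* p) * h   ≡⟨ cong (_* h) (ℤ.pos-* K′ p) ⟩
    + K′ * + p * h     ≡⟨ cong (_* h) (ℤ.*-comm (+ K′) (+ p)) ⟩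
    + p * + K′ * h     ≡⟨ ℤ.*-assoc (+ p) (+ K′) h ⟩
    + p * (+ K′ * h)   ∎)
    where open ≡-Reasoning

  ∤⇒∣ₚ : ∀ {p} → Prime p → ∀ {m K′} P H → ¬ + p ∣ℤ m →
         (∀ i → m * coeff P i ≡ + (K′ ℕ.* p) * coeff H i) → p ∣ₚ P
  ∤⇒∣ₚ {p} p-prime {m} {K′} P H p∤m eq i
    with euclidsLemmaℤ p-prime m (coeff P i) (divides (+ K′ * coeff H i) (begin
      m * coeff P i                ≡⟨ eq i ⟩
      + (K′ ℕ.* p) * coeff H i     ≡⟨ cong (_* coeff H i) (ℤ.pos-* K′ p) ⟩
      + K′ * + p * coeff H i       ≡⟨ xy∙z≈xz∙y (+ K′) (+ p) (coeff H i) ⟩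
      + K′ * coeff H i * + p       ∎))
    where open ≡-Reasoning
  ... | inj₁ p∣m = contradiction p∣m p∤m
  ... | inj₂ p∣P = p∣P

  module _ {H : List ℤ} (noProper : NoProperFactorisation H) where

    -- Clearing denominators in a factorisation of H/m over ℚ gives m·(F*G) = K·H over ℤ.  The
    -- primes p of K are removed one at a time: p divides m, or by ∣ₚ-*ₚ it divides F or G
    -- coefficientwise.

    TrivialAtScale : ℕ → Set
    TrivialAtScale K = ∀ {m} F G → m ≢ 0ℤ → (∀ i → m * coeff (F *ₚ G) i ≡ + K * coeff H i) →
                       Constant F ⊎ Constant G

    trivialAtScale-1 : TrivialAtScale 1
    trivialAtScale-1 {m} F G m≢0 eq =
      Sum.map₁ (DegreeBelow-·ₚ⁻¹ F m≢0)
               (noProper (m ·ₚ F) G λ i → trans (coeff-·ₚ-*ₚ m F G i) (trans (eq i) (ℤ.*-identityˡ _)))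

    trivialAtScale-*prime : ∀ {p K′} → Prime p → TrivialAtScale K′ → TrivialAtScale (K′ ℕ.* p)
    trivialAtScale-*prime {p} {K′} p-prime trivial {m} F G m≢0 eq with + p ∣? m
    ... | yes (divides m′ m≡m′p) = trivial {m′} F G (λ { refl → m≢0 m≡m′p }) λ i →
            cancelPrime p-prime m′ _ K′ _ (trans (sym (ℤ.*-assoc m′ (+ p) _)) (trans (cong (_* _) (sym m≡m′p)) (eq i)))
    ... | no p∤m with ∣ₚ-*ₚ p-prime F G (∤⇒∣ₚ p-prime {m} {K′} (F *ₚ G) H p∤m eq)
    ...   | inj₁ p∣F with ∣ₚ⇒·ₚ F p∣F
    ...     | F₁ , refl = Sum.map₁ (DegreeBelow-·ₚ (+ p) F₁) (trivial F₁ G m≢0 λ i →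
                cancelPrime p-prime m _ K′ _ (trans (cong (m *_) (sym (coeff-·ₚ-*ₚ (+ p) F₁ G i))) (eq i)))
    trivialAtScale-*prime {p} {K′} p-prime trivial {m} F G m≢0 eq | no p∤m | inj₂ p∣G with ∣ₚ⇒·ₚ G p∣G
    ...     | G₁ , refl = Sum.map₂ (DegreeBelow-·ₚ (+ p) G₁) (trivial F G₁ m≢0 λ i →
                cancelPrime p-prime m _ K′ _ (trans (cong (m *_) (sym (coeff-*ₚ-·ₚ (+ p) F G₁ i))) (eq i)))

    trivialAtScale : ∀ K → Acc ℕ._<_ K → K ≢ 0 → TrivialAtScale K
    trivialAtScale zero             _         K≢0 = contradiction refl K≢0
    trivialAtScale 1                _         _   = trivialAtScale-1
    trivialAtScale K@(suc (suc _)) (acc rec) _   with primeFactor K (ℕ.s≤s (ℕ.s≤s ℕ.z≤n))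
    ... | p , p-prime , ℕ.divides K′ K≡K′p =
      subst TrivialAtScale (sym K≡K′p) (trivialAtScale-*prime {p} {K′} p-prime (trivialAtScale K′ (rec K′<K) K′≢0))
      where
      K′≢0 : K′ ≢ 0
      K′≢0 refl = contradiction K≡K′p λ ()
      K′<K : K′ ℕ.< K
      K′<K = subst (K′ ℕ.<_) (sym K≡K′p)
               (ℕ.m<m*n K′ p {{ℕ.≢-nonZero K′≢0}} (ℕ.nonTrivial⇒n>1 p {{prime⇒nonTrivial p-prime}}))

    gaussLemma : ∀ {m} K F G → m ≢ 0ℤ → K ≢ 0 →
                 (∀ i → m * coeff (F *ₚ G) i ≡ + K * coeff H i) → Constant F ⊎ Constant G
    gaussLemma K F G m≢0 K≢0 = trivialAtScale K (<-wellFounded K) K≢0 F G m≢0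

  -- Small values at many integers force a trivial factorisation

  infixl 7 _÷[X-_]

  _÷[X-_] : List ℤ → ℤ → List ℤ
  []      ÷[X- z ] = []
  (g ∷ G) ÷[X- z ] = G +ₚ z ·ₚ (G ÷[X- z ])

  eval-÷[X-] : ∀ G z x → eval G x ≡ (x - z) * eval (G ÷[X- z ]) x + eval G z
  eval-÷[X-] []      z x = sym (trans (ℤ.+-identityʳ _) (ℤ.*-zeroʳ (x - z)))
  eval-÷[X-] (g ∷ G) z x = begin
    g + x * eval G x
      ≡⟨ cong (λ e → g + x * e) ih ⟩
    g + x * ((x - z) * q + eval G z)
      ≡⟨ rearrange g x z q (eval G z) ⟩
    (x - z) * ((x - z) * q + eval G z + z * q) + (g + z * eval G z)
      ≡⟨ cong (λ e → (x - z) * (e + z * q) + (g + z * eval G z)) ih ⟨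
    (x - z) * (eval G x + z * q) + (g + z * eval G z)
      ≡⟨ cong (λ e → (x - z) * e + (g + z * eval G z))
              (trans (eval-+ₚ G (z ·ₚ (G ÷[X- z ])) x) (cong (λ e → eval G x + e) (eval-·ₚ z (G ÷[X- z ]) x))) ⟨
    (x - z) * eval (G +ₚ z ·ₚ (G ÷[X- z ])) x + (g + z * eval G z) ∎
    where
    open ≡-Reasoning
    q  = eval (G ÷[X- z ]) x
    ih = eval-÷[X-] G z x
    rearrange : ∀ g x z q e → g + x * ((x - z) * q + e) ≡ (x - z) * ((x - z) * q + e + z * q) + (g + z * e)
    rearrange = solve-∀

  DegreeBelow-÷[X-] : ∀ G z k → DegreeBelow G (suc k) → DegreeBelow (G ÷[X- z ]) k
  DegreeBelow-÷[X-] []      z k dG = λ _ → refl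
  DegreeBelow-÷[X-] (g ∷ G) z k dG =
    DegreeBelow-+ₚ G (z ·ₚ (G ÷[X- z ])) dG
      (DegreeBelow-·ₚ z (G ÷[X- z ]) (DegreeBelow-÷[X-] G z k (DegreeBelow-mono G (ℕ.n≤1+n k) dG)))

  coeff-÷[X-]-leading : ∀ G z k → DegreeBelow G (suc (suc k)) → coeff (G ÷[X- z ]) k ≡ coeff G (suc k)
  coeff-÷[X-]-leading []      z k dG = refl
  coeff-÷[X-]-leading (g ∷ G) z k dG = begin
    coeff (G +ₚ z ·ₚ (G ÷[X- z ])) k
      ≡⟨ coeff-+ₚ G _ k ⟩
    coeff G k + coeff (z ·ₚ (G ÷[X- z ])) k
      ≡⟨ cong (λ e → coeff G k + e) (coeff-·ₚ z (G ÷[X- z ]) k) ⟩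
    coeff G k + z * coeff (G ÷[X- z ]) k
      ≡⟨ cong (λ c → coeff G k + z * c) (coeff-beyond (G ÷[X- z ]) (DegreeBelow-÷[X-] G z k dG) ℕ.≤-refl) ⟩
    coeff G k + z * 0ℤ
      ≡⟨ trans (cong (λ e → coeff G k + e) (ℤ.*-zeroʳ z)) (ℤ.+-identityʳ _) ⟩
    coeff G k ∎
    where open ≡-Reasoning

  ∣x∣≤∣y*x∣ : ∀ x y → y ≢ 0ℤ → ∣ x ∣ ℕ.≤ ∣ y * x ∣
  ∣x∣≤∣y*x∣ x y y≢0 = subst (∣ x ∣ ℕ.≤_) (sym (ℤ.abs-* y x)) (ℕ.m≤n*m ∣ x ∣ ∣ y ∣ {{ℤ.≢-nonZero y≢0}})

  eval-÷[X-]-bound : ∀ G {z₀ z V} → z₀ ≢ z → ∣ eval G z₀ ∣ ℕ.≤ V → ∣ eval G z ∣ ℕ.≤ V →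
                     ∣ eval (G ÷[X- z₀ ]) z ∣ ℕ.≤ V ℕ.+ V
  eval-÷[X-]-bound G {z₀} {z} {V} z₀≢z Gz₀≤V Gz≤V = begin
    ∣ eval (G ÷[X- z₀ ]) z ∣
      ≤⟨ ∣x∣≤∣y*x∣ (eval (G ÷[X- z₀ ]) z) (z - z₀) (z₀≢z ∘ sym ∘ ℤ.i-j≡0⇒i≡j z z₀) ⟩
    ∣ (z - z₀) * eval (G ÷[X- z₀ ]) z ∣
      ≡⟨ cong ∣_∣ (sym (trans (cong (_- eval G z₀) (eval-÷[X-] G z₀ z))
                             (+-cancel ((z - z₀) * eval (G ÷[X- z₀ ]) z) (eval G z₀)))) ⟩
    ∣ eval G z - eval G z₀ ∣
      ≤⟨ ℤ.∣i-j∣≤∣i∣+∣j∣ (eval G z) (eval G z₀) ⟩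
    ∣ eval G z ∣ ℕ.+ ∣ eval G z₀ ∣
      ≤⟨ ℕ.+-mono-≤ Gz≤V Gz₀≤V ⟩
    V ℕ.+ V ∎
    where
    open ℕ.≤-Reasoning
    +-cancel : ∀ a b → a + b - b ≡ a
    +-cancel = solve-∀

  -- G = (X − z₀)·(G ÷[X- z₀ ]) + G(z₀) and |z − z₀| ≥ 1 at the other nodes z, so the quotient is
  -- bounded by 2V there; its leading coefficient is that of G.
  coeff-bound : ∀ k G zs V → DegreeBelow G (suc k) → Unique zs → suc k ℕ.≤ length zs →
                All (λ z → ∣ eval G z ∣ ℕ.≤ V) zs → ∣ coeff G k ∣ ℕ.≤ 2 ℕ.^ k ℕ.* V
  coeff-bound zero G (z ∷ zs) V dG _ _ (Gz≤V ∷ _) = begin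
    ∣ coeff G 0 ∣   ≡⟨ cong ∣_∣ (eval-constant G z dG) ⟨
    ∣ eval G z ∣    ≤⟨ Gz≤V ⟩
    V               ≡⟨ ℕ.*-identityˡ V ⟨
    1 ℕ.* V         ∎
    where open ℕ.≤-Reasoning
  coeff-bound (suc k) G (z₀ ∷ zs) V dG (z₀∉zs ∷ unique) (ℕ.s≤s k<len) (Gz₀≤V ∷ G≤V) = begin
    ∣ coeff G (suc k) ∣
      ≡⟨ cong ∣_∣ (coeff-÷[X-]-leading G z₀ k dG) ⟨
    ∣ coeff (G ÷[X- z₀ ]) k ∣
      ≤⟨ coeff-bound k (G ÷[X- z₀ ]) zs (V ℕ.+ V) (DegreeBelow-÷[X-] G z₀ (suc k) dG) unique k<len
           (All.zipWith (λ (z₀≢z , Gz≤V) → eval-÷[X-]-bound G z₀≢z Gz₀≤V Gz≤V) (z₀∉zs , G≤V)) ⟩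
    2 ℕ.^ k ℕ.* (V ℕ.+ V)
      ≡⟨ double (2 ℕ.^ k) V ⟩
    2 ℕ.^ suc k ℕ.* V ∎
    where
    open ℕ.≤-Reasoning
    double : ∀ a V → a ℕ.* (V ℕ.+ V) ≡ 2 ℕ.* a ℕ.* V
    double = ℕ-Solver.solve-∀

  ∣factor∣≤ : ∀ F G H {z V} → F *ₚ G ≈ₚ H → eval H z ≢ 0ℤ → ∣ eval H z ∣ ℕ.≤ V → ∣ eval F z ∣ ℕ.≤ V
  ∣factor∣≤ F G H {z} {V} FG≈H Hz≢0 Hz≤V = begin
    ∣ eval F z ∣                  ≤⟨ ∣x∣≤∣y*x∣ (eval F z) (eval G z) (Hz≢0 ∘ Gz≡0⇒Hz≡0) ⟩
    ∣ eval G z * eval F z ∣       ≡⟨ cong ∣_∣ (trans (ℤ.*-comm (eval G z) (eval F z)) (sym Hz≡FzGz)) ⟩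
    ∣ eval H z ∣                  ≤⟨ Hz≤V ⟩
    V                             ∎
    where
    open ℕ.≤-Reasoning
    Hz≡FzGz : eval H z ≡ eval F z * eval G z
    Hz≡FzGz = trans (sym (eval-cong (F *ₚ G) H z FG≈H)) (eval-*ₚ F G z)
    Gz≡0⇒Hz≡0 : eval G z ≡ 0ℤ → eval H z ≡ 0ℤ
    Gz≡0⇒Hz≡0 Gz≡0 = trans Hz≡FzGz (trans (cong (eval F z *_) Gz≡0) (ℤ.*-zeroʳ (eval F z)))

  smallValues⇒NoProperFactorisation :
    ∀ {H n zs V} → HasDegree H n → n ℕ.≤ length zs → Unique zs →
    (2 ℕ.^ n ℕ.* V) ℕ.* (2 ℕ.^ n ℕ.* V) ℕ.< ∣ coeff H n ∣ →
    All (λ z → eval H z ≢ 0ℤ × ∣ eval H z ∣ ℕ.≤ V) zs → NoProperFactorisation H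
  smallValues⇒NoProperFactorisation {H} {n} {zs} {V} hH n≤len unique lead>bound values F G FG≈H
    with ≈[]⊎HasDegree ℤ._≟_ F | ≈[]⊎HasDegree ℤ._≟_ G
  ... | inj₁ F≈0 | _ = contradiction (trans (sym (FG≈H n)) (≈[]-*ₚ F G F≈0 n)) (proj₂ hH)
  ... | inj₂ _ | inj₁ G≈0 = contradiction (trans (sym (FG≈H n)) (*ₚ-≈[] F G G≈0 n)) (proj₂ hH)
  ... | inj₂ (zero , hF) | inj₂ _ = inj₁ (proj₁ hF)
  ... | inj₂ (suc _ , _) | inj₂ (zero , hG) = inj₂ (proj₁ hG)
  ... | inj₂ (s@(suc _) , hF) | inj₂ (t@(suc _) , hG) = contradiction lead≤bound (ℕ.<⇒≱ lead>bound)
    where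
    s+t≡n : s ℕ.+ t ≡ n
    s+t≡n = HasDegree-unique (F *ₚ G) H FG≈H (HasDegree-*ₚ {F} {G} hF hG) hH
    leadBound : ∀ P k → HasDegree P k → k ℕ.< n → All (λ z → ∣ eval P z ∣ ℕ.≤ V) zs →
                ∣ coeff P k ∣ ℕ.≤ 2 ℕ.^ n ℕ.* V
    leadBound P k hP k<n bounded =
      ℕ.≤-trans (coeff-bound k P zs V (proj₁ hP) unique (ℕ.≤-trans k<n n≤len) bounded)
                (ℕ.*-monoˡ-≤ V (ℕ.^-monoʳ-≤ 2 (ℕ.<⇒≤ k<n)))
    valuesF : All (λ z → ∣ eval F z ∣ ℕ.≤ V) zs
    valuesF = All.map (λ (Hz≢0 , Hz≤V) → ∣factor∣≤ F G H FG≈H Hz≢0 Hz≤V) values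
    valuesG : All (λ z → ∣ eval G z ∣ ℕ.≤ V) zs
    valuesG = All.map (λ (Hz≢0 , Hz≤V) → ∣factor∣≤ G F H (λ i → trans (*ₚ-comm G F i) (FG≈H i)) Hz≢0 Hz≤V)
                      values
    lead≤bound : ∣ coeff H n ∣ ℕ.≤ (2 ℕ.^ n ℕ.* V) ℕ.* (2 ℕ.^ n ℕ.* V)
    lead≤bound = begin
      ∣ coeff H n ∣
        ≡⟨ cong ∣_∣ (trans (sym (FG≈H n)) (cong (coeff (F *ₚ G)) (sym s+t≡n))) ⟩
      ∣ coeff (F *ₚ G) (s ℕ.+ t) ∣
        ≡⟨ cong ∣_∣ (coeff-*ₚ-leading F G s t (proj₁ hF) (proj₁ hG)) ⟩
      ∣ coeff F s * coeff G t ∣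
        ≡⟨ ℤ.abs-* (coeff F s) (coeff G t) ⟩
      ∣ coeff F s ∣ ℕ.* ∣ coeff G t ∣
        ≤⟨ ℕ.*-mono-≤ (leadBound F s hF (subst (s ℕ.<_) s+t≡n (ℕ.m<m+n s ℕ.z<s)) valuesF)
                      (leadBound G t hG (subst (t ℕ.<_) s+t≡n (ℕ.m<n+m t ℕ.z<s)) valuesG) ⟩
      (2 ℕ.^ n ℕ.* V) ℕ.* (2 ℕ.^ n ℕ.* V) ∎
      where open ℕ.≤-Reasoning

  -- Integer interpolants with small nonzero values

  ∏[X-_] : List ℤ → List ℤ
  ∏[X- []     ] = 1ℤ ∷ []
  ∏[X- z ∷ zs ] = (- z ∷ 1ℤ ∷ []) *ₚ ∏[X- zs ]

  eval-∏[X-] : ∀ zs x → eval ∏[X- zs ] x ≡ foldr _*_ 1ℤ (map (λ y → x - y) zs)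
  eval-∏[X-] []       x = trans (cong (λ e → 1ℤ + e) (ℤ.*-zeroʳ x)) (ℤ.+-identityʳ 1ℤ)
  eval-∏[X-] (z ∷ zs) x =
    trans (eval-*ₚ (- z ∷ 1ℤ ∷ []) ∏[X- zs ] x) (cong₂ _*_ (linear z x) (eval-∏[X-] zs x))
    where
    linear : ∀ z x → - z + x * (1ℤ + x * 0ℤ) ≡ x - z
    linear = solve-∀

  DegreeBelow-∏[X-] : ∀ zs {k} → length zs ≡ k → DegreeBelow ∏[X- zs ] (suc k)
  DegreeBelow-∏[X-] []       refl = λ _ → refl
  DegreeBelow-∏[X-] (z ∷ zs) refl =
    DegreeBelow-*ₚ (- z ∷ 1ℤ ∷ []) ∏[X- zs ] 1 (length zs) (λ _ → refl) (DegreeBelow-∏[X-] zs refl)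

  coeff-∏[X-]-leading : ∀ zs {k} → length zs ≡ k → coeff ∏[X- zs ] k ≡ 1ℤ
  coeff-∏[X-]-leading []       refl = refl
  coeff-∏[X-]-leading (z ∷ zs) refl = begin
    coeff ((- z ∷ 1ℤ ∷ []) *ₚ ∏[X- zs ]) (suc (length zs))
      ≡⟨ coeff-*ₚ-leading (- z ∷ 1ℤ ∷ []) ∏[X- zs ] 1 (length zs) (λ _ → refl) (DegreeBelow-∏[X-] zs refl) ⟩
    1ℤ * coeff ∏[X- zs ] (length zs)   ≡⟨ ℤ.*-identityˡ _ ⟩
    coeff ∏[X- zs ] (length zs)        ≡⟨ coeff-∏[X-]-leading zs refl ⟩
    1ℤ                                 ∎
    where open ≡-Reasoning

  ∏[X-]-vanishes : ∀ {x zs} → x ∈ zs → eval ∏[X- zs ] x ≡ 0ℤ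
  ∏[X-]-vanishes {x} {z ∷ zs} x∈zs = trans (eval-∏[X-] (z ∷ zs) x) (product≡0 x∈zs)
    where
    product≡0 : ∀ {zs} → x ∈ zs → foldr _*_ 1ℤ (map (λ y → x - y) zs) ≡ 0ℤ
    product≡0 {_ ∷ zs} (here refl)  =
      trans (cong (_* foldr _*_ 1ℤ (map (λ y → x - y) zs)) (ℤ.+-inverseʳ x))
            (ℤ.*-zeroˡ (foldr _*_ 1ℤ (map (λ y → x - y) zs)))
    product≡0 {z ∷ _}  (there x∈zs) = trans (cong ((x - z) *_) (product≡0 x∈zs)) (ℤ.*-zeroʳ (x - z))

  ∏[X-]-nonvanishing : ∀ {x zs} → All (x ≢_) zs → eval ∏[X- zs ] x ≢ 0ℤ
  ∏[X-]-nonvanishing {x} {zs} x∉zs eq = product≢0 x∉zs (trans (sym (eval-∏[X-] zs x)) eq)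
    where
    product≢0 : ∀ {zs} → All (x ≢_) zs → foldr _*_ 1ℤ (map (λ y → x - y) zs) ≢ 0ℤ
    product≢0 []             ()
    product≢0 (x≢z ∷ x∉zs) eq =
      [ x≢z ∘ ℤ.i-j≡0⇒i≡j x _ , product≢0 x∉zs ]′ (ℤ.i*j≡0⇒i≡0∨j≡0 (x - _) eq)

  prodDiffs≢0 : ∀ {zs} → Unique zs → prodDiffs zs ≢ 0ℤ
  prodDiffs≢0 []                  ()
  prodDiffs≢0 {z ∷ zs} (z∉zs ∷ unique) eq =
    [ ∏[X-]-nonvanishing z∉zs ∘ trans (eval-∏[X-] zs z) , prodDiffs≢0 unique ]′ (ℤ.i*j≡0⇒i≡0∨j≡0 _ eq)

  eval-+ₚ-·ₚ∏[X-] : ∀ P c {zs x} → x ∈ zs → eval (P +ₚ c ·ₚ ∏[X- zs ]) x ≡ eval P x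
  eval-+ₚ-·ₚ∏[X-] P c {zs} {x} x∈zs = begin
    eval (P +ₚ c ·ₚ ∏[X- zs ]) x
      ≡⟨ eval-+ₚ P _ x ⟩
    eval P x + eval (c ·ₚ ∏[X- zs ]) x
      ≡⟨ cong (λ e → eval P x + e) (eval-·ₚ c ∏[X- zs ] x) ⟩
    eval P x + c * eval ∏[X- zs ] x
      ≡⟨ cong (λ e → eval P x + c * e) (∏[X-]-vanishes x∈zs) ⟩
    eval P x + c * 0ℤ
      ≡⟨ trans (cong (λ e → eval P x + e) (ℤ.*-zeroʳ c)) (ℤ.+-identityʳ _) ⟩
    eval P x ∎
    where open ≡-Reasoning

  -- Newton's scheme kept integral: the previous interpolant P, scaled by A = ∏ⱼ (a₀ − aⱼ), has the
  -- right values at the other nodes, where the correction term vanishes; the correction fixes the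
  -- value at a₀.  All values pick up the factor A · prodDiffs (tail) = prodDiffs (tabulate a).
  interpolate : ∀ {r} → (Fin r → ℤ) → (Fin r → ℤ) → List ℤ
  interpolate {zero}  a v = []
  interpolate {suc r} a v =
    eval ∏[X- as ] (a zero) ·ₚ P +ₚ (prodDiffs as * v zero - eval P (a zero)) ·ₚ ∏[X- as ]
    where
    as = tabulate (a ∘ suc)
    P  = interpolate (a ∘ suc) (v ∘ suc)

  DegreeBelow-interpolate : ∀ {r} (a v : Fin r → ℤ) → DegreeBelow (interpolate a v) r
  DegreeBelow-interpolate {zero}  a v = λ _ → refl
  DegreeBelow-interpolate {suc r} a v = DegreeBelow-+ₚ (A ·ₚ P) (c ·ₚ ∏[X- as ])
    (DegreeBelow-·ₚ A P (DegreeBelow-mono P (ℕ.n≤1+n r) (DegreeBelow-interpolate (a ∘ suc) (v ∘ suc))))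
    (DegreeBelow-·ₚ c ∏[X- as ] (DegreeBelow-∏[X-] as (List.length-tabulate (a ∘ suc))))
    where
    as = tabulate (a ∘ suc)
    P  = interpolate (a ∘ suc) (v ∘ suc)
    A  = eval ∏[X- as ] (a zero)
    c  = prodDiffs as * v zero - eval P (a zero)

  interpolate-eval : ∀ {r} (a v : Fin r → ℤ) i → eval (interpolate a v) (a i) ≡ prodDiffs (tabulate a) * v i
  interpolate-eval {suc r} a v i = begin
    eval (A ·ₚ P +ₚ c ·ₚ ∏[X- as ]) (a i)
      ≡⟨ eval-+ₚ (A ·ₚ P) (c ·ₚ ∏[X- as ]) (a i) ⟩
    eval (A ·ₚ P) (a i) + eval (c ·ₚ ∏[X- as ]) (a i)
      ≡⟨ cong₂ _+_ (eval-·ₚ A P (a i)) (eval-·ₚ c ∏[X- as ] (a i)) ⟩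
    A * eval P (a i) + c * eval ∏[X- as ] (a i)
      ≡⟨ atNode i ⟩
    A * prodDiffs as * v i
      ≡⟨ cong (λ e → e * prodDiffs as * v i) (eval-∏[X-] as (a zero)) ⟩
    prodDiffs (tabulate a) * v i ∎
    where
    open ≡-Reasoning
    as = tabulate (a ∘ suc)
    P  = interpolate (a ∘ suc) (v ∘ suc)
    A  = eval ∏[X- as ] (a zero)
    c  = prodDiffs as * v zero - eval P (a zero)
    atNode : ∀ i → A * eval P (a i) + c * eval ∏[X- as ] (a i) ≡ A * prodDiffs as * v i
    atNode zero    = solveAt0 A (eval P (a zero)) (prodDiffs as) (v zero)
      where
      solveAt0 : ∀ A p M w → A * p + (M * w - p) * A ≡ A * M * w
      solveAt0 = solve-∀
    atNode (suc j) = begin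
      A * eval P (a (suc j)) + c * eval ∏[X- as ] (a (suc j))
        ≡⟨ cong₂ (λ e f → A * e + c * f) (interpolate-eval (a ∘ suc) (v ∘ suc) j) (∏[X-]-vanishes (∈-tabulate⁺ j)) ⟩
      A * (prodDiffs as * v (suc j)) + c * 0ℤ
        ≡⟨ solveAtSuc A (prodDiffs as) (v (suc j)) c ⟩
      A * prodDiffs as * v (suc j) ∎
      where
      solveAtSuc : ∀ A M w c → A * (M * w) + c * 0ℤ ≡ A * M * w
      solveAtSuc = solve-∀

  sumAbs : List ℤ → ℕ
  sumAbs = sum ∘ map ∣_∣

  ∣∣≤sumAbs : ∀ {x xs} → x ∈ xs → ∣ x ∣ ℕ.≤ sumAbs xs
  ∣∣≤sumAbs {xs = x ∷ xs} (here refl)  = ℕ.m≤m+n ∣ x ∣ (sumAbs xs)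
  ∣∣≤sumAbs {xs = y ∷ xs} (there x∈xs) = ℕ.≤-trans (∣∣≤sumAbs x∈xs) (ℕ.m≤n+m (sumAbs xs) ∣ y ∣)

  sumAbs-fresh : ∀ xs → All (+ suc (sumAbs xs) ≢_) xs
  sumAbs-fresh xs = All.tabulate λ x∈xs e≡x →
    ℕ.<-irrefl refl (subst (λ x → ∣ x ∣ ℕ.≤ sumAbs xs) (sym e≡x) (∣∣≤sumAbs x∈xs))

  nonzeroShift : ∀ x {y} → y ≢ 0ℤ → ∃ λ c → x + c * y ≢ 0ℤ
  nonzeroShift x {y} y≢0 with x ℤ.≟ 0ℤ
  ... | yes refl = 1ℤ , λ eq → y≢0 (trans (sym (trans (ℤ.+-identityˡ _) (ℤ.*-identityˡ y))) eq)
  ... | no  x≢0  = 0ℤ , λ eq → x≢0 (trans (sym (ℤ.+-identityʳ x)) eq)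

  record Interpolant {r} (a w : Fin r → ℤ) (k : ℕ) : Set where
    field
      nodes         : List ℤ
      poly          : List ℤ
      length-nodes  : length nodes ≡ k
      unique-nodes  : Unique nodes
      a∈nodes       : ∀ i → a i ∈ nodes
      degree-poly   : DegreeBelow poly k
      nonzero-poly  : All (λ z → eval poly z ≢ 0ℤ) nodes
      poly-values   : ∀ i → eval poly (a i) ≡ w i

  interpolant : ∀ {r} (a v : Fin r → ℤ) → (∀ {i j} → a i ≡ a j → i ≡ j) → (∀ i → v i ≢ 0ℤ) →
                Interpolant a (λ i → prodDiffs (tabulate a) * v i) r
  interpolant a v a-injective v≢0 = record
    { nodes        = tabulate a
    ; poly         = interpolate a v
    ; length-nodes = List.length-tabulate a
    ; unique-nodes = Unique.tabulate⁺ a-injective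
    ; a∈nodes      = ∈-tabulate⁺
    ; degree-poly  = DegreeBelow-interpolate a v
    ; nonzero-poly = All.tabulate⁺ λ i eq →
        [ prodDiffs≢0 (Unique.tabulate⁺ a-injective) , v≢0 i ]′
          (ℤ.i*j≡0⇒i≡0∨j≡0 _ (trans (sym (interpolate-eval a v i)) eq))
    ; poly-values  = interpolate-eval a v
    }

  -- The new node 1 + Σ |z| is not among the old ones, and c is chosen so that the value there is
  -- nonzero; adding c·∏[X- nodes ] changes no old value.
  extend : ∀ {r} {a w : Fin r → ℤ} {k} → Interpolant a w k → Interpolant a w (suc k)
  extend {k = k} I = record
    { nodes        = e ∷ nodes
    ; poly         = poly +ₚ c ·ₚ ∏[X- nodes ]
    ; length-nodes = cong suc length-nodes
    ; unique-nodes = sumAbs-fresh nodes ∷ unique-nodes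
    ; a∈nodes      = there ∘ a∈nodes
    ; degree-poly  = DegreeBelow-+ₚ poly (c ·ₚ ∏[X- nodes ]) (DegreeBelow-mono poly (ℕ.n≤1+n k) degree-poly)
                                       (DegreeBelow-·ₚ c ∏[X- nodes ] (DegreeBelow-∏[X-] nodes length-nodes))
    ; nonzero-poly = subst (_≢ 0ℤ) (sym eval-at-e) (proj₂ shift)
                     ∷ All.tabulate (λ {z} z∈nodes →
                         subst (_≢ 0ℤ) (sym (eval-+ₚ-·ₚ∏[X-] poly c z∈nodes)) (All.lookup nonzero-poly z∈nodes))
    ; poly-values  = λ i → trans (eval-+ₚ-·ₚ∏[X-] poly c (a∈nodes i)) (poly-values i)
    }
    where
    open Interpolant I
    e = + suc (sumAbs nodes)
    shift = nonzeroShift (eval poly e) (∏[X-]-nonvanishing (sumAbs-fresh nodes))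
    c = proj₁ shift
    eval-at-e : eval (poly +ₚ c ·ₚ ∏[X- nodes ]) e ≡ eval poly e + c * eval ∏[X- nodes ] e
    eval-at-e = trans (eval-+ₚ poly _ e) (cong (λ x → eval poly e + x) (eval-·ₚ c ∏[X- nodes ] e))

  extendTo : ∀ {r} {a w : Fin r → ℤ} {k n} → k ℕ.≤′ n → Interpolant a w k → Interpolant a w n
  extendTo (ℕ.≤′-reflexive refl) I = I
  extendTo (ℕ.≤′-step k≤′n)      I = extend (extendTo k≤′n I)

  integerInterpolant : ∀ {r n} (a v : Fin r → ℤ) → (∀ {i j} → a i ≡ a j → i ≡ j) → (∀ i → v i ≢ 0ℤ) →
    r ℕ.≤ n →
    ∃ λ H → HasDegree H n × NoProperFactorisation H × (∀ i → eval H (a i) ≡ prodDiffs (tabulate a) * v i)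
  integerInterpolant {n = n} a v a-injective v≢0 r≤n =
    H , (degree-H , leading≢0) ,
    smallValues⇒NoProperFactorisation {H} (degree-H , leading≢0) (ℕ.≤-reflexive (sym length-nodes)) unique-nodes
      (subst (bound ℕ.<_) (cong ∣_∣ (sym leading)) (ℕ.n<1+n bound)) small ,
    λ i → trans (eval-+ₚ-·ₚ∏[X-] poly (+ L) (a∈nodes i)) (poly-values i)
    where
    open Interpolant (extendTo (ℕ.≤⇒≤′ r≤n) (interpolant a v a-injective v≢0))
    V     = sumAbs (map (eval poly) nodes)
    bound = (2 ℕ.^ n ℕ.* V) ℕ.* (2 ℕ.^ n ℕ.* V)
    L     = suc bound
    H     = poly +ₚ (+ L) ·ₚ ∏[X- nodes ]
    degree-H : DegreeBelow H (suc n)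
    degree-H = DegreeBelow-+ₚ poly _ (DegreeBelow-mono poly (ℕ.n≤1+n n) degree-poly)
                 (DegreeBelow-·ₚ (+ L) ∏[X- nodes ] (DegreeBelow-∏[X-] nodes length-nodes))
    leading : coeff H n ≡ + L
    leading = begin
      coeff H n
        ≡⟨ coeff-+ₚ poly _ n ⟩
      coeff poly n + coeff ((+ L) ·ₚ ∏[X- nodes ]) n
        ≡⟨ cong₂ _+_ (coeff-beyond poly degree-poly ℕ.≤-refl) (coeff-·ₚ (+ L) ∏[X- nodes ] n) ⟩
      0ℤ + + L * coeff ∏[X- nodes ] n
        ≡⟨ cong (λ c → 0ℤ + + L * c) (coeff-∏[X-]-leading nodes length-nodes) ⟩
      0ℤ + + L * 1ℤ
        ≡⟨ trans (ℤ.+-identityˡ _) (ℤ.*-identityʳ (+ L)) ⟩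
      + L ∎
      where open ≡-Reasoning
    leading≢0 : coeff H n ≢ 0ℤ
    leading≢0 eq = contradiction (trans (sym leading) eq) λ ()
    small : All (λ z → eval H z ≢ 0ℤ × ∣ eval H z ∣ ℕ.≤ V) nodes
    small = All.tabulate λ {z} z∈nodes →
      subst (λ h → h ≢ 0ℤ × ∣ h ∣ ℕ.≤ V) (sym (eval-+ₚ-·ₚ∏[X-] poly (+ L) z∈nodes))
        (All.lookup nonzero-poly z∈nodes , ∣∣≤sumAbs (∈-map⁺ (eval poly) z∈nodes))

-- Passing to ℚ[X]

-- toℚ z is by definition fromℚᵘ (mkℚᵘ z 0).
toℚᵘ-toℚ : ∀ z → ℚ.toℚᵘ (toℚ z) ℚᵘ.≃ mkℚᵘ z 0
toℚᵘ-toℚ z = ℚ.toℚᵘ-fromℚᵘ (mkℚᵘ z 0)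

toℚ-+ : ∀ a b → toℚ (a ℤ.+ b) ≡ toℚ a ℚ.+ toℚ b
toℚ-+ a b = ℚ.toℚᵘ-injective (begin
  ℚ.toℚᵘ (toℚ (a ℤ.+ b))              ≈⟨ toℚᵘ-toℚ (a ℤ.+ b) ⟩
  mkℚᵘ (a ℤ.+ b) 0                     ≈⟨ *≡* (+-over-1 a b) ⟩
  mkℚᵘ a 0 ℚᵘ.+ mkℚᵘ b 0               ≈⟨ ℚᵘ.+-cong (toℚᵘ-toℚ a) (toℚᵘ-toℚ b) ⟨
  ℚ.toℚᵘ (toℚ a) ℚᵘ.+ ℚ.toℚᵘ (toℚ b)   ≈⟨ ℚ.toℚᵘ-homo-+ (toℚ a) (toℚ b) ⟨
  ℚ.toℚᵘ (toℚ a ℚ.+ toℚ b)             ∎)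
  where
  open import Relation.Binary.Reasoning.Setoid ℚᵘ.≃-setoid
  +-over-1 : ∀ a b → (a ℤ.+ b) ℤ.* ℤ.1ℤ ≡ (a ℤ.* ℤ.1ℤ ℤ.+ b ℤ.* ℤ.1ℤ) ℤ.* ℤ.1ℤ
  +-over-1 = solve-∀

toℚ-* : ∀ a b → toℚ (a ℤ.* b) ≡ toℚ a ℚ.* toℚ b
toℚ-* a b = ℚ.toℚᵘ-injective (begin
  ℚ.toℚᵘ (toℚ (a ℤ.* b))              ≈⟨ toℚᵘ-toℚ (a ℤ.* b) ⟩
  mkℚᵘ a 0 ℚᵘ.* mkℚᵘ b 0               ≈⟨ ℚᵘ.*-cong (toℚᵘ-toℚ a) (toℚᵘ-toℚ b) ⟨
  ℚ.toℚᵘ (toℚ a) ℚᵘ.* ℚ.toℚᵘ (toℚ b)   ≈⟨ ℚ.toℚᵘ-homo-* (toℚ a) (toℚ b) ⟨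
  ℚ.toℚᵘ (toℚ a ℚ.* toℚ b)             ∎)
  where open import Relation.Binary.Reasoning.Setoid ℚᵘ.≃-setoid

toℚ-injective : ∀ {a b} → toℚ a ≡ toℚ b → a ≡ b
toℚ-injective {a} {b} eq with ℚ.fromℚᵘ-injective {mkℚᵘ a 0} {mkℚᵘ b 0} eq
... | *≡* a*1≡b*1 = trans (sym (ℤ.*-identityʳ a)) (trans a*1≡b*1 (ℤ.*-identityʳ b))

toℚ≢0 : ∀ {z} → z ≢ ℤ.0ℤ → toℚ z ≢ 0ℚ
toℚ≢0 z≢0 = z≢0 ∘ toℚ-injective

*↧≡↥ : ∀ x → x ℚ.* toℚ (↧ x) ≡ toℚ (↥ x)
*↧≡↥ x@(mkℚ n d _) = ℚ.toℚᵘ-injective (begin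
  ℚ.toℚᵘ (x ℚ.* toℚ (↧ x))             ≈⟨ ℚ.toℚᵘ-homo-* x (toℚ (↧ x)) ⟩
  mkℚᵘ n d ℚᵘ.* ℚ.toℚᵘ (toℚ (↧ x))     ≈⟨ ℚᵘ.*-congˡ {mkℚᵘ n d} (toℚᵘ-toℚ (↧ x)) ⟩
  mkℚᵘ n d ℚᵘ.* mkℚᵘ (↧ x) 0           ≈⟨ *≡* (cancel n (↧ x)) ⟩
  mkℚᵘ n 0                             ≈⟨ toℚᵘ-toℚ n ⟨
  ℚ.toℚᵘ (toℚ n)                       ∎)
  where
  open import Relation.Binary.Reasoning.Setoid ℚᵘ.≃-setoid
  cancel : ∀ n e → (n ℤ.* e) ℤ.* ℤ.1ℤ ≡ n ℤ.* (e ℤ.* ℤ.1ℤ)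
  cancel = solve-∀

module ℚ[X] = Polynomial ℚ.+-*-isCommutativeRing

ℚ-*-cancelˡ : ∀ {c x y} → c ≢ 0ℚ → c ℚ.* x ≡ c ℚ.* y → x ≡ y
ℚ-*-cancelˡ {c} {x} {y} c≢0 eq = begin
  x                   ≡⟨ ℚ.*-identityˡ x ⟨
  1ℚ ℚ.* x            ≡⟨ cong (ℚ._* x) (ℚ.*-inverseˡ c) ⟨
  c⁻¹ ℚ.* c ℚ.* x     ≡⟨ ℚ.*-assoc c⁻¹ c x ⟩
  c⁻¹ ℚ.* (c ℚ.* x)   ≡⟨ cong (c⁻¹ ℚ.*_) eq ⟩
  c⁻¹ ℚ.* (c ℚ.* y)   ≡⟨ ℚ.*-assoc c⁻¹ c y ⟨
  c⁻¹ ℚ.* c ℚ.* y     ≡⟨ cong (ℚ._* y) (ℚ.*-inverseˡ c) ⟩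
  1ℚ ℚ.* y            ≡⟨ ℚ.*-identityˡ y ⟩
  y                   ∎
  where
  open ≡-Reasoning
  instance _ = ℚ.≢-nonZero c≢0
  c⁻¹ = ℚ.1/ c

ℚ-noZeroDivisors : ∀ {x y} → x ℚ.* y ≡ 0ℚ → x ≡ 0ℚ ⊎ y ≡ 0ℚ
ℚ-noZeroDivisors {x} {y} xy≡0 with x ℚ.≟ 0ℚ
... | yes x≡0 = inj₁ x≡0
... | no  x≢0 = inj₂ (ℚ-*-cancelˡ x≢0 (trans xy≡0 (sym (ℚ.*-zeroʳ x))))

module _ where
  open ℚ[X] hiding (_+_; _*_)
  open ℚ[X].IntegralDomain ℚ-noZeroDivisors
  open import Data.Integer using (+_)

  map-toℚ-coeff : ∀ F i → coeff (map toℚ F) i ≡ toℚ (ℤ[X].coeff F i)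
  map-toℚ-coeff []      i       = refl
  map-toℚ-coeff (a ∷ F) zero    = refl
  map-toℚ-coeff (a ∷ F) (suc i) = map-toℚ-coeff F i

  map-toℚ-+ₚ : ∀ F G → map toℚ (F ℤ[X].+ₚ G) ≡ map toℚ F +ₚ map toℚ G
  map-toℚ-+ₚ []      G       = refl
  map-toℚ-+ₚ (a ∷ F) []      = refl
  map-toℚ-+ₚ (a ∷ F) (b ∷ G) = cong₂ _∷_ (toℚ-+ a b) (map-toℚ-+ₚ F G)

  map-toℚ-·ₚ : ∀ c F → map toℚ (c ℤ[X].·ₚ F) ≡ toℚ c ·ₚ map toℚ F
  map-toℚ-·ₚ c []      = refl
  map-toℚ-·ₚ c (a ∷ F) = cong₂ _∷_ (toℚ-* c a) (map-toℚ-·ₚ c F)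

  map-toℚ-*ₚ : ∀ F G → map toℚ (F ℤ[X].*ₚ G) ≡ map toℚ F *ₚ map toℚ G
  map-toℚ-*ₚ []      G = refl
  map-toℚ-*ₚ (a ∷ F) G = trans (map-toℚ-+ₚ (a ℤ[X].·ₚ G) (ℤ.0ℤ ∷ F ℤ[X].*ₚ G))
    (cong₂ _+ₚ_ (map-toℚ-·ₚ a G) (cong (0ℚ ∷_) (map-toℚ-*ₚ F G)))

  eval-map-toℚ : ∀ F x → eval (map toℚ F) (toℚ x) ≡ toℚ (ℤ[X].eval F x)
  eval-map-toℚ []      x = refl
  eval-map-toℚ (a ∷ F) x = sym (begin
    toℚ (a ℤ.+ x ℤ.* ℤ[X].eval F x)
      ≡⟨ toℚ-+ a _ ⟩
    toℚ a ℚ.+ toℚ (x ℤ.* ℤ[X].eval F x)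
      ≡⟨ cong (toℚ a ℚ.+_) (toℚ-* x _) ⟩
    toℚ a ℚ.+ toℚ x ℚ.* toℚ (ℤ[X].eval F x)
      ≡⟨ cong (λ e → toℚ a ℚ.+ toℚ x ℚ.* e) (eval-map-toℚ F x) ⟨
    toℚ a ℚ.+ toℚ x ℚ.* eval (map toℚ F) (toℚ x) ∎)
    where open ≡-Reasoning

  toℚ-pos-* : ∀ a b → toℚ (+ (a ℕ.* b)) ≡ toℚ (+ a) ℚ.* toℚ (+ b)
  toℚ-pos-* a b = trans (cong toℚ (ℤ.pos-* a b)) (toℚ-* (+ a) (+ b))

  Cleared : List ℚ → Set
  Cleared f = ∃ λ D → ∃ λ F → D ≢ 0 × map toℚ F ≡ toℚ (+ D) ·ₚ f

  clearDenominators : ∀ f → Cleared f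
  clearDenominators []      = 1 , [] , (λ ()) , refl
  clearDenominators (x ∷ f) with clearDenominators f
  ... | D , F , D≢0 , F≡Df =
    ↧ₙ x ℕ.* D , (↥ x ℤ.* + D) ∷ (↧ x ℤ[X].·ₚ F) , xD≢0 , cong₂ _∷_ head tail
    where
    xD≢0 : ↧ₙ x ℕ.* D ≢ 0
    xD≢0 = [ (λ ()) , D≢0 ]′ ∘ ℕ.m*n≡0⇒m≡0∨n≡0 (↧ₙ x)
    head : toℚ (↥ x ℤ.* + D) ≡ toℚ (+ (↧ₙ x ℕ.* D)) ℚ.* x
    head = begin
      toℚ (↥ x ℤ.* + D)                     ≡⟨ toℚ-* (↥ x) (+ D) ⟩
      toℚ (↥ x) ℚ.* toℚ (+ D)               ≡⟨ cong (ℚ._* toℚ (+ D)) (*↧≡↥ x) ⟨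
      x ℚ.* toℚ (↧ x) ℚ.* toℚ (+ D)         ≡⟨ ℚ.*-assoc x _ _ ⟩
      x ℚ.* (toℚ (↧ x) ℚ.* toℚ (+ D))       ≡⟨ ℚ.*-comm x _ ⟩
      toℚ (↧ x) ℚ.* toℚ (+ D) ℚ.* x         ≡⟨ cong (ℚ._* x) (toℚ-pos-* (↧ₙ x) D) ⟨
      toℚ (+ (↧ₙ x ℕ.* D)) ℚ.* x            ∎
      where open ≡-Reasoning
    tail : map toℚ (↧ x ℤ[X].·ₚ F) ≡ toℚ (+ (↧ₙ x ℕ.* D)) ·ₚ f
    tail = begin
      map toℚ (↧ x ℤ[X].·ₚ F)               ≡⟨ map-toℚ-·ₚ (↧ x) F ⟩
      toℚ (↧ x) ·ₚ map toℚ F                ≡⟨ cong (toℚ (↧ x) ·ₚ_) F≡Df ⟩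
      toℚ (↧ x) ·ₚ toℚ (+ D) ·ₚ f           ≡⟨ ·ₚ-·ₚ (toℚ (↧ x)) (toℚ (+ D)) f ⟩
      (toℚ (↧ x) ℚ.* toℚ (+ D)) ·ₚ f        ≡⟨ cong (_·ₚ f) (toℚ-pos-* (↧ₙ x) D) ⟨
      toℚ (+ (↧ₙ x ℕ.* D)) ·ₚ f             ∎
      where open ≡-Reasoning

  coeff-Defs : ∀ p i → Defs.coeff p i ≡ coeff p i
  coeff-Defs []      i       = refl
  coeff-Defs (a ∷ p) zero    = refl
  coeff-Defs (a ∷ p) (suc i) = coeff-Defs p i

  +ₚ-Defs : ∀ p q → p Defs.+ₚ q ≡ p +ₚ q
  +ₚ-Defs []      q       = refl
  +ₚ-Defs (a ∷ p) []      = refl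
  +ₚ-Defs (a ∷ p) (b ∷ q) = cong (a ℚ.+ b ∷_) (+ₚ-Defs p q)

  *ₚ-Defs : ∀ p q → p Defs.*ₚ q ≡ p *ₚ q
  *ₚ-Defs []      q = refl
  *ₚ-Defs (a ∷ p) q =
    trans (+ₚ-Defs (a ·ₚ q) (0ℚ ∷ p Defs.*ₚ q)) (cong (λ r → a ·ₚ q +ₚ (0ℚ ∷ r)) (*ₚ-Defs p q))

  eval-Defs : ∀ p x → Defs.eval p x ≡ eval p x
  eval-Defs []      x = refl
  eval-Defs (a ∷ p) x = cong (λ e → a ℚ.+ x ℚ.* e) (eval-Defs p x)

  fromDefs-≈ₚ : ∀ p q → p Defs.≈ₚ q → p ≈ₚ q
  fromDefs-≈ₚ p q p≈q i = trans (sym (coeff-Defs p i)) (trans (p≈q i) (coeff-Defs q i))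

  IsUnit : List ℚ → Set
  IsUnit p = ∃ λ q → p *ₚ q ≈ₚ 1ℚ ∷ []

  fromDefs-IsUnit : ∀ p → Defs.IsUnit p → IsUnit p
  fromDefs-IsUnit p (q , pq≈1) = q , subst (_≈ₚ 1ℚ ∷ []) (*ₚ-Defs p q) (fromDefs-≈ₚ (p Defs.*ₚ q) (1ℚ ∷ []) pq≈1)

  toDefs-IsUnit : ∀ p → IsUnit p → Defs.IsUnit p
  toDefs-IsUnit p (q , pq≈1) = q , λ i →
    trans (coeff-Defs (p Defs.*ₚ q) i)
          (trans (cong (λ r → coeff r i) (*ₚ-Defs p q)) (trans (pq≈1 i) (sym (coeff-Defs (1ℚ ∷ []) i))))

  constant⇒IsUnit : ∀ f → Constant f → coeff f 0 ≢ 0ℚ → IsUnit f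
  constant⇒IsUnit f f-constant c≢0 = c⁻¹ ∷ [] , λ i → trans (*ₚ-comm f (c⁻¹ ∷ []) i) (coeffs i)
    where
    c = coeff f 0
    instance _ = ℚ.≢-nonZero c≢0
    c⁻¹ = ℚ.1/ c
    coeffs : ∀ i → coeff ((c⁻¹ ∷ []) *ₚ f) i ≡ coeff (1ℚ ∷ []) i
    coeffs i = trans (coeff-+ₚ (c⁻¹ ·ₚ f) (0ℚ ∷ []) i)
      (trans (cong₂ ℚ._+_ (coeff-·ₚ c⁻¹ f i) (0∷[]≈[] i)) (trans (ℚ.+-identityʳ _) (scaled i)))
      where
      0∷[]≈[] : 0ℚ ∷ [] ≈ₚ []
      0∷[]≈[] zero    = refl
      0∷[]≈[] (suc _) = refl
      scaled : ∀ i → c⁻¹ ℚ.* coeff f i ≡ coeff (1ℚ ∷ []) i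
      scaled zero    = ℚ.*-inverseˡ c
      scaled (suc i) = trans (cong (c⁻¹ ℚ.*_) (f-constant i)) (ℚ.*-zeroʳ c⁻¹)

  module ScaledIrreducible {H : List ℤ} {n : ℕ} {m : ℤ} (degree-H : ℤ[X].HasDegree H (suc n))
                           (noProper : NoProperFactorisation H) (m≢0 : m ≢ ℤ.0ℤ)
                           (α : List ℚ) (mα≈H : toℚ m ·ₚ α ≈ₚ map toℚ H) where

    degree-α : HasDegree α (suc n)
    degree-α = HasDegree-·ₚ⁻¹ α (toℚ≢0 m≢0)
                 (HasDegree-cong (map toℚ H) (toℚ m ·ₚ α) (sym ∘ mα≈H) degree-map-toℚ-H)
      where
      degree-map-toℚ-H : HasDegree (map toℚ H) (suc n)
      degree-map-toℚ-H = (λ j → trans (map-toℚ-coeff H _) (cong toℚ (proj₁ degree-H j))) ,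
                         toℚ≢0 (proj₂ degree-H) ∘ trans (sym (map-toℚ-coeff H (suc n)))

    α≉0 : ¬ α ≈ₚ []
    α≉0 α≈0 = proj₂ degree-α (α≈0 (suc n))

    ¬IsUnit : ¬ IsUnit α
    ¬IsUnit (q , αq≈1) = positiveDegree⇒¬*ₚ≈1 ℚ._≟_ (λ ()) {α} q degree-α αq≈1

    constantFactor⇒IsUnit : ∀ f g → α ≈ₚ f *ₚ g → Constant f → IsUnit f
    constantFactor⇒IsUnit f g α≈fg f-constant = constant⇒IsUnit f f-constant λ f₀≡0 →
      α≉0 λ i → trans (α≈fg i) (≈[]-*ₚ f g (λ { zero → f₀≡0 ; (suc j) → f-constant j }) i)

    clearedConstant : ∀ {D F} f → D ≢ 0 → map toℚ F ≡ toℚ (+ D) ·ₚ f → ℤ[X].Constant F → Constant f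
    clearedConstant {D} {F} f D≢0 F≡Df F-constant = DegreeBelow-·ₚ⁻¹ f (toℚ≢0 (D≢0 ∘ ℤ.+-injective))
      (subst Constant F≡Df λ j → trans (map-toℚ-coeff F (suc j)) (cong toℚ (F-constant j)))

    scaledProduct : ∀ f g Df Dg F G → α ≈ₚ f *ₚ g →
                    map toℚ F ≡ toℚ (+ Df) ·ₚ f → map toℚ G ≡ toℚ (+ Dg) ·ₚ g →
                    ∀ i → m ℤ.* ℤ[X].coeff (F ℤ[X].*ₚ G) i ≡ + (Df ℕ.* Dg) ℤ.* ℤ[X].coeff H i
    scaledProduct f g Df Dg F G α≈fg F≡Df G≡Dg i = toℚ-injective (begin
      toℚ (m ℤ.* ℤ[X].coeff (F ℤ[X].*ₚ G) i)
        ≡⟨ toℚ-* m _ ⟩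
      m′ ℚ.* toℚ (ℤ[X].coeff (F ℤ[X].*ₚ G) i)
        ≡⟨ cong (m′ ℚ.*_) (map-toℚ-coeff (F ℤ[X].*ₚ G) i) ⟨
      m′ ℚ.* coeff (map toℚ (F ℤ[X].*ₚ G)) i
        ≡⟨ cong (λ p → m′ ℚ.* coeff p i) (trans (map-toℚ-*ₚ F G) (cong₂ _*ₚ_ F≡Df G≡Dg)) ⟩
      m′ ℚ.* coeff (Df′ ·ₚ f *ₚ Dg′ ·ₚ g) i
        ≡⟨ cong (m′ ℚ.*_) (trans (coeff-·ₚ-*ₚ Df′ f _ i) (cong (Df′ ℚ.*_) (coeff-*ₚ-·ₚ Dg′ f g i))) ⟩
      m′ ℚ.* (Df′ ℚ.* (Dg′ ℚ.* coeff (f *ₚ g) i))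
        ≡⟨ cong (λ c → m′ ℚ.* (Df′ ℚ.* (Dg′ ℚ.* c))) (α≈fg i) ⟨
      m′ ℚ.* (Df′ ℚ.* (Dg′ ℚ.* coeff α i))
        ≡⟨ trans (x∙yz≈y∙xz m′ Df′ _) (cong (Df′ ℚ.*_) (x∙yz≈y∙xz m′ Dg′ _)) ⟩
      Df′ ℚ.* (Dg′ ℚ.* (m′ ℚ.* coeff α i))
        ≡⟨ cong (λ c → Df′ ℚ.* (Dg′ ℚ.* c)) (trans (sym (coeff-·ₚ m′ α i)) (mα≈H i)) ⟩
      Df′ ℚ.* (Dg′ ℚ.* coeff (map toℚ H) i)
        ≡⟨ cong (λ c → Df′ ℚ.* (Dg′ ℚ.* c)) (map-toℚ-coeff H i) ⟩
      Df′ ℚ.* (Dg′ ℚ.* toℚ (ℤ[X].coeff H i))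
        ≡⟨ ℚ.*-assoc Df′ Dg′ _ ⟨
      Df′ ℚ.* Dg′ ℚ.* toℚ (ℤ[X].coeff H i)
        ≡⟨ cong (ℚ._* toℚ (ℤ[X].coeff H i)) (toℚ-pos-* Df Dg) ⟨
      toℚ (+ (Df ℕ.* Dg)) ℚ.* toℚ (ℤ[X].coeff H i)
        ≡⟨ toℚ-* (+ (Df ℕ.* Dg)) _ ⟨
      toℚ (+ (Df ℕ.* Dg) ℤ.* ℤ[X].coeff H i) ∎)
      where
      open ≡-Reasoning
      open import Algebra.Properties.CommutativeSemigroup (CommutativeRing.*-commutativeSemigroup ℚ.+-*-commutativeRing)
        using (x∙yz≈y∙xz)
      m′ = toℚ m
      Df′ = toℚ (+ Df)
      Dg′ = toℚ (+ Dg)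

    factorisation : ∀ f g → α ≈ₚ f *ₚ g → IsUnit f ⊎ IsUnit g
    factorisation f g α≈fg = fromCleared (clearDenominators f) (clearDenominators g)
      where
      fromCleared : Cleared f → Cleared g → IsUnit f ⊎ IsUnit g
      fromCleared (Df , F , Df≢0 , F≡Df) (Dg , G , Dg≢0 , G≡Dg) =
        Sum.map (constantFactor⇒IsUnit f g α≈fg ∘ clearedConstant f Df≢0 F≡Df)
                (constantFactor⇒IsUnit g f (λ i → trans (α≈fg i) (*ₚ-comm f g i)) ∘ clearedConstant g Dg≢0 G≡Dg)
                (gaussLemma {H} noProper (Df ℕ.* Dg) F G m≢0 ([ Df≢0 , Dg≢0 ]′ ∘ ℕ.m*n≡0⇒m≡0∨n≡0 Df)
                  (scaledProduct f g Df Dg F G α≈fg F≡Df G≡Dg))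

    irreducible : Defs.Irreducible α
    irreducible =
      α≉0 ∘ fromDefs-≈ₚ α [] ,
      ¬IsUnit ∘ fromDefs-IsUnit α ,
      λ f g α≈fg → Sum.map (toDefs-IsUnit f) (toDefs-IsUnit g)
                     (factorisation f g λ i →
                        trans (fromDefs-≈ₚ α (f Defs.*ₚ g) α≈fg i) (cong (λ p → coeff p i) (*ₚ-Defs f g)))

  coefficientVector : ∀ N → (ℕ → ℚ) → Vec ℚ N
  coefficientVector zero    c = []
  coefficientVector (suc N) c = c 0 ∷ coefficientVector N (c ∘ suc)

  coeff-coefficientVector : ∀ N c → (∀ j → c (N ℕ.+ j) ≡ 0ℚ) →
                            ∀ i → coeff (toList (coefficientVector N c)) i ≡ c i
  coeff-coefficientVector zero    c c≡0 i       = sym (c≡0 i)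
  coeff-coefficientVector (suc N) c c≡0 zero    = refl
  coeff-coefficientVector (suc N) c c≡0 (suc i) = coeff-coefficientVector N (c ∘ suc) c≡0 i

  lookup-coefficientVector : ∀ N c k → lookup (coefficientVector N c) k ≡ c (toℕ k)
  lookup-coefficientVector (suc N) c zero    = refl
  lookup-coefficientVector (suc N) c (suc k) = lookup-coefficientVector N (c ∘ suc) k

  last-coefficientVector : ∀ N c → last (coefficientVector (suc N) c) ≡ c N
  last-coefficientVector zero    c = refl
  last-coefficientVector (suc N) c = last-coefficientVector N (c ∘ suc)

  rationalInterpolant : ∀ {n} H m → ℤ[X].HasDegree H (suc n) → NoProperFactorisation H → m ≢ ℤ.0ℤ →
    ∃ λ (α : Vec ℚ (2 ℕ.+ n)) → Defs.Irreducible (toList α) ×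
      (∀ x w → ℤ[X].eval H x ≡ m ℤ.* w → Defs.eval (toList α) (toℚ x) ≡ toℚ w) ×
      ¬ last α ≡ 0ℚ × (∀ k → ∃ λ z → toℚ m ℚ.* lookup α k ≡ toℚ z)
  rationalInterpolant {n} H m degree-H noProper m≢0 = αᵥ , irreducible , values , last≢0 , integral
    where
    instance _ = ℚ.≢-nonZero (toℚ≢0 m≢0)
    m⁻¹ = ℚ.1/ toℚ m
    c : ℕ → ℚ
    c k = m⁻¹ ℚ.* toℚ (ℤ[X].coeff H k)
    mc≡H : ∀ k → toℚ m ℚ.* c k ≡ toℚ (ℤ[X].coeff H k)
    mc≡H k = trans (sym (ℚ.*-assoc (toℚ m) m⁻¹ _))
                   (trans (cong (ℚ._* _) (ℚ.*-inverseʳ (toℚ m))) (ℚ.*-identityˡ _))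
    αᵥ = coefficientVector (2 ℕ.+ n) c
    α  = toList αᵥ
    coeff-α : ∀ i → coeff α i ≡ c i
    coeff-α = coeff-coefficientVector (2 ℕ.+ n) c λ j →
      trans (cong (λ h → m⁻¹ ℚ.* toℚ h) (proj₁ degree-H j)) (ℚ.*-zeroʳ m⁻¹)
    mα≈H : toℚ m ·ₚ α ≈ₚ map toℚ H
    mα≈H i = trans (coeff-·ₚ (toℚ m) α i)
                   (trans (cong (toℚ m ℚ.*_) (coeff-α i)) (trans (mc≡H i) (sym (map-toℚ-coeff H i))))
    open ScaledIrreducible {H} {n} {m} degree-H noProper m≢0 α mα≈H using (irreducible)
    values : ∀ x w → ℤ[X].eval H x ≡ m ℤ.* w → Defs.eval α (toℚ x) ≡ toℚ w
    values x w Hx≡mw = trans (eval-Defs α (toℚ x)) (ℚ-*-cancelˡ (toℚ≢0 m≢0) (begin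
      toℚ m ℚ.* eval α (toℚ x)          ≡⟨ eval-·ₚ (toℚ m) α (toℚ x) ⟨
      eval (toℚ m ·ₚ α) (toℚ x)         ≡⟨ eval-cong _ (map toℚ H) (toℚ x) mα≈H ⟩
      eval (map toℚ H) (toℚ x)          ≡⟨ eval-map-toℚ H x ⟩
      toℚ (ℤ[X].eval H x)               ≡⟨ cong toℚ Hx≡mw ⟩
      toℚ (m ℤ.* w)                     ≡⟨ toℚ-* m w ⟩
      toℚ m ℚ.* toℚ w                   ∎))
      where open ≡-Reasoning
    last≢0 : ¬ last αᵥ ≡ 0ℚ
    last≢0 last≡0 = proj₂ degree-H (toℚ-injective (begin
      toℚ (ℤ[X].coeff H (suc n))
        ≡⟨ mc≡H (suc n) ⟨
      toℚ m ℚ.* c (suc n)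
        ≡⟨ cong (toℚ m ℚ.*_) (trans (sym (last-coefficientVector (suc n) c)) last≡0) ⟩
      toℚ m ℚ.* 0ℚ
        ≡⟨ ℚ.*-zeroʳ (toℚ m) ⟩
      0ℚ ∎))
      where open ≡-Reasoning
    integral : ∀ k → ∃ λ z → toℚ m ℚ.* lookup αᵥ k ≡ toℚ z
    integral k = ℤ[X].coeff H (toℕ k) ,
                 trans (cong (toℚ m ℚ.*_) (lookup-coefficientVector (2 ℕ.+ n) c k)) (mc≡H (toℕ k))

-- Opened only here: the polynomial modules above have their own _+_, _*_ and eval.
open import Data.Nat using (_≤_; _+_; _*_)
open import Data.Integer using (_^_)
open import Data.Rational using () renaming (_*_ to _*ℚ_)
open Defs using (Acceptable; Irreducible; eval)

lemma2p3 : (r : ℕ) (a b : Fin r → ℤ) → 1 ≤ r → Acceptable r a b →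
    (n : ℕ) → r ≤ n →
    ∃ λ (α : Vec ℚ (1 + n)) →
      Irreducible (toList α) ×
      (∀ i → eval (toList α) (toℚ (a i)) ≡ toℚ (b i ^ (18 * r + 3))) ×
      ¬ (last α ≡ 0ℚ) ×
      (∀ k → ∃ λ (z : ℤ) → toℚ (prodDiffs (tabulate a)) *ℚ lookup α k ≡ toℚ z)
lemma2p3 (suc r) a b _ (a-injective , _ , b≢0) (suc n) (ℕ.s≤s r≤n) =
  let (H , degree-H , noProper , H-values) = integerInterpolant a v (a-injective _ _) v≢0 (ℕ.s≤s r≤n)
      (α , irreducible , values , last≢0 , integral) =
        rationalInterpolant H (prodDiffs (tabulate a)) degree-H noProper (prodDiffs≢0 (Unique.tabulate⁺ (a-injective _ _)))
  in  α , irreducible , (λ i → values (a i) (v i) (H-values i)) , last≢0 , integral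
  where
  v : Fin (suc r) → ℤ
  v i = b i ^ (18 * suc r + 3)
  v≢0 : ∀ i → v i ≢ ℤ.0ℤ
  v≢0 i = b≢0 i ∘ ℤ.i^n≡0⇒i≡0 (b i) (18 * suc r + 3)
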